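{- Let $a,b$ be nonnegative integers, $1\le s_1<s_2<\dots<s_a\le a+b$, and let $\{r_1<\dots<r_b\}=[a+b]\setminus\{s_1,\dots,s_a\}$. Let $x,y$ be positive reals and $q$ an indeterminate. Weight the lozenges of the dented semihexagon $\mathcal{SH}_{a,b}(s_1,\dots,s_a)$ as follows: in each row, number the down-pointing unit triangles $1,2,\dots$ from left to right; a right-tilting (resp. left-tilting) lozenge containing the $j$-th down-pointing triangle of its row has weight $xq^{j}$ (resp. $yq^{j}$), and each vertical lozenge has weight $1$. Then the sum of the weights of all lozenge tilings of this region equals \[x^{ab} \left(\frac{y}{x}\right)^{\sum_{i=1}^{b}(r_i-i)} q^{ab(b-a)/2+a\sum_{i=1}^{b}(r_i-i)}\, s_{\lambda(s_1,\dots,s_a)}(q,q^{2},\dots,q^{a}).\]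
   Context: Work in the triangular lattice with horizontal lattice lines and unit triangles of side 1; let $\eta=\sqrt3/2$. The semihexagon $\mathcal{SH}_{a,b}$ is the trapezoid with vertices $(0,0)$, $(a+b,0)$, $(b+a/2,a\eta)$, $(a/2,a\eta)$ (base $a+b$, top $b$, two slanted sides $a$). Its $i$-th row ($1\le i\le a$) is the part between heights $(i-1)\eta$ and $i\eta$; it contains $a+b-i$ down-pointing unit triangles. The region $\mathcal{SH}_{a,b}(s_1,\dots,s_a)$ is obtained by removing from the bottom row the up-pointing unit triangles with base $[k-1,k]\times\{0\}$ for $k\in\{s_1,\dots,s_a\}$. A lozenge is the union of two unit triangles sharing an edge: vertical if the shared edge is horizontal; otherwise it lies in one row, contains exactly one down-pointing triangle, and has a horizontal top and bottom side; it is right-tilting if its top side is its bottom side translated by $(1/2,\eta)$, left-tilting if translated by $(-1/2,\eta)$. A lozenge tiling covers the region by lozenges without gaps or overlaps; its weight is the product of its lozenges' weights. For a finite set $X=\{x_1<\dots<x_k\}$ of positive integers, $\lambda(X)=(x_k-k,\dots,x_1-1)$ (zero parts allowed), and $s_\lambda$ denotes the Schur polynomial. -}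

module Defs where

open import Level using (Level)
open import Data.Bool using (Bool; true; false; _∧_; _∨_; not; if_then_else_)
open import Data.Nat using (ℕ; zero; suc; _∸_; _≡ᵇ_; _<ᵇ_; _≤ᵇ_)
open import Data.List using (List; []; _∷_; map; concatMap; filterᵇ; length; foldr; zip; upTo)
open import Data.Bool.ListAction using (any; all)
import Data.Nat as N
open import Data.Vec using (Vec; toList)
open import Data.Product using (_×_; _,_)
open import Algebra.Bundles using (CommutativeRing)

range1 : ℕ → List ℕ
range1 n = map suc (upTo n)

index1 : ∀ {A : Set} → List A → List (ℕ × A)
index1 xs = zip (range1 (length xs)) xs

listsOf : ∀ {A : Set} → List A → ℕ → List (List A)
listsOf xs zero    = [] ∷ []
listsOf xs (suc n) = concatMap (λ x → map (x ∷_) (listsOf xs n)) xs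

rowFamilies : ∀ {A : Set} → List A → List ℕ → List (List (List A))
rowFamilies xs []       = [] ∷ []
rowFamilies xs (l ∷ ls) =
  concatMap (λ r → map (r ∷_) (rowFamilies xs ls)) (listsOf xs l)

elemℕ : ℕ → List ℕ → Bool
elemℕ k xs = any (k ≡ᵇ_) xs

countᵇ : ∀ {A : Set} → (A → Bool) → List A → ℕ
countᵇ p []       = 0
countᵇ p (x ∷ xs) = (if p x then 1 else 0) N.+ countᵇ p xs

module _ {c ℓ : Level} (R : CommutativeRing c ℓ) where
  open CommutativeRing R

  pow : Carrier → ℕ → Carrier
  pow x zero    = 1#
  pow x (suc n) = x * pow x n

  sumR : List Carrier → Carrier
  sumR = foldr _+_ 0#

  prodR : List Carrier → Carrier
  prodR = foldr _*_ 1#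

-- Coordinates (1-based, as in the paper).  Row i (1 ≤ i ≤ a) of SH_{a,b}
-- contains a+b-i+1 up-pointing unit triangles  up(i,k), 1 ≤ k ≤ a+b-i+1,
-- numbered left to right (up(i,k) has base
-- [(i-1)/2 + k-1 , (i-1)/2 + k] × {(i-1)η}), and a+b-i down-pointing unit
-- triangles down(i,j), 1 ≤ j ≤ a+b-i, numbered left to right; down(i,j)
-- lies between up(i,j) and up(i,j+1), and its top (horizontal) edge is
-- the base of up(i+1,j).
-- The region SH_{a,b}(s) consists of all these triangles except the
-- up-pointing triangles up(1,k), k ∈ {s_1,...,s_a}  (base [k-1,k] × {0}).

upInRegion : (a b : ℕ) → List ℕ → ℕ → ℕ → Bool
upInRegion a b s i k =
  (1 ≤ᵇ i) ∧ (i ≤ᵇ a) ∧ (1 ≤ᵇ k) ∧ (k ≤ᵇ (a N.+ b N.+ 1 ∸ i))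
    ∧ not ((i ≡ᵇ 1) ∧ elemℕ k s)

-- A lozenge contains exactly one down-pointing triangle.  Given the
-- down-pointing triangle down(i,j), the lozenge is determined by which of
-- its three neighbouring up-pointing triangles it is paired with:
--   rightTilt : with up(i,j)   (left neighbour;  the lozenge's top side is
--                               its bottom side translated by (1/2,η))
--   leftTilt  : with up(i,j+1) (right neighbour; top side = bottom side
--                               translated by (-1/2,η))
--   vertical  : with up(i+1,j) (shared edge horizontal)
data Dir : Set where
  rightTilt leftTilt vertical : Dir

allDirs : List Dir
allDirs = rightTilt ∷ leftTilt ∷ vertical ∷ []

-- a lozenge, recorded as (i , j , d): down(i,j) together with direction d
Lozenge : Set
Lozenge = ℕ × ℕ × Dir

upOf : Lozenge → ℕ × ℕ
upOf (i , j , rightTilt) = i , j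
upOf (i , j , leftTilt)  = i , suc j
upOf (i , j , vertical)  = suc i , j

downCount : (a b i : ℕ) → ℕ
downCount a b i = a N.+ b ∸ i

-- A candidate is a choice of direction for every down-pointing triangle
-- of the region: a list of rows (row i = i-th entry, 1 ≤ i ≤ a), row i
-- being a list of a+b-i directions.  Every down-pointing triangle of
-- the region is the down triangle of exactly one lozenge of the
-- candidate.
candidates : (a b : ℕ) → List (List (List Dir))
candidates a b = rowFamilies allDirs (map (downCount a b) (range1 a))

lozengesOf : List (List Dir) → List Lozenge
lozengesOf rows =
  concatMap (λ { (i , row) → map (λ { (j , d) → i , j , d }) (index1 row) })
            (index1 rows)

upEq : ℕ × ℕ → ℕ × ℕ → Bool
upEq (i , k) (i' , k') = (i ≡ᵇ i') ∧ (k ≡ᵇ k')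

upsOfRegion : (a b : ℕ) → List ℕ → List (ℕ × ℕ)
upsOfRegion a b s =
  filterᵇ (λ { (i , k) → upInRegion a b s i k })
    (concatMap (λ i → map (λ k → i , k) (range1 (a N.+ b N.+ 1 ∸ i))) (range1 a))

-- A candidate is a lozenge tiling of SH_{a,b}(s) iff every lozenge lies
-- in the region (its up triangle belongs to the region; its down
-- triangle does by construction) and every up-pointing triangle of the
-- region lies in exactly one lozenge (down-pointing ones do by
-- construction): no gaps, no overlaps.
isTiling : (a b : ℕ) → List ℕ → List (List Dir) → Bool
isTiling a b s rows =
  all (λ l → let (i , k) = upOf l in upInRegion a b s i k) (lozengesOf rows)
  ∧ all (λ u → countᵇ (λ l → upEq (upOf l) u) (lozengesOf rows) ≡ᵇ 1)
        (upsOfRegion a b s)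

tilings : (a b : ℕ) → List ℕ → List (List (List Dir))
tilings a b s = filterᵇ (isTiling a b s) (candidates a b)

module _ {c ℓ : Level} (R : CommutativeRing c ℓ) where
  open CommutativeRing R

  lozengeWeight : (x y q : Carrier) → Lozenge → Carrier
  lozengeWeight x y q (i , j , rightTilt) = x * pow R q j
  lozengeWeight x y q (i , j , leftTilt)  = y * pow R q j
  lozengeWeight x y q (i , j , vertical)  = 1#

  tilingWeight : (x y q : Carrier) → List (List Dir) → Carrier
  tilingWeight x y q rows = prodR R (map (lozengeWeight x y q) (lozengesOf rows))

  weightedTilings : (a b : ℕ) → List ℕ → (x y q : Carrier) → Carrier
  weightedTilings a b s x y q = sumR R (map (tilingWeight x y q) (tilings a b s))

-- λ(X) for X = {x_1 < ... < x_k} given as the increasing list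
-- (x_1,...,x_k):  λ(X) = (x_k - k, ..., x_1 - 1)
lambdaOf : List ℕ → List ℕ
lambdaOf xs = foldr (λ p acc → acc Data.List.++ (p ∷ [])) []
                (map (λ { (i , x) → x ∸ i }) (index1 xs))
  where import Data.List

weaklyIncr : List ℕ → Bool
weaklyIncr []           = true
weaklyIncr (x ∷ [])     = true
weaklyIncr (x ∷ y ∷ xs) = (x ≤ᵇ y) ∧ weaklyIncr (y ∷ xs)

colStrict : List ℕ → List ℕ → Bool
colStrict (x ∷ xs) (y ∷ ys) = (x <ᵇ y) ∧ colStrict xs ys
colStrict _        _        = true

columnsStrict : List (List ℕ) → Bool
columnsStrict []            = true
columnsStrict (r ∷ [])      = true
columnsStrict (r ∷ r' ∷ rs) = colStrict r r' ∧ columnsStrict (r' ∷ rs)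

isSSYT : List (List ℕ) → Bool
isSSYT T = all weaklyIncr T ∧ columnsStrict T

ssyt : (λ' : List ℕ) (n : ℕ) → List (List (List ℕ))
ssyt λ' n = filterᵇ isSSYT (rowFamilies (range1 n) λ')

module _ {c ℓ : Level} (R : CommutativeRing c ℓ) where
  open CommutativeRing R

  var : List Carrier → ℕ → Carrier
  var []       k       = 0#
  var (v ∷ vs) zero    = 0#
  var (v ∷ vs) (suc zero) = v
  var (v ∷ vs) (suc (suc k)) = var vs (suc k)

  schur : List ℕ → List Carrier → Carrier
  schur λ' xs =
    sumR R (map (λ T → prodR R (map (var xs) (concatMapId T))) (ssyt λ' (length xs)))
    where
      concatMapId : List (List ℕ) → List ℕ
      concatMapId = concatMap (λ r → r)

complementList : (a b : ℕ) → List ℕ → List ℕ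
complementList a b s = filterᵇ (λ k → not (elemℕ k s)) (range1 (a N.+ b))

-- Σ_{i=1}^{b} (r_i - i)   (each r_i ≥ i, so ∸ is ordinary subtraction)
sumRminusI : (a b : ℕ) → List ℕ → ℕ
sumRminusI a b s =
  foldr N._+_ 0 (map (λ { (i , r) → r ∸ i }) (index1 (complementList a b s)))

choose2 : ℕ → ℕ
choose2 zero    = 0
choose2 (suc n) = n N.+ choose2 n

-- Peel off the bottom row.  In a tiling of SH_{a+1,b}(S) the bottom row is determined by the positions E of its
-- vertical lozenges, which are the dents of the tiled region SH_{a,b}(E) above it, and the rows that occur are exactly
-- those with s₁ ≤ e₁ < s₂ ≤ e₂ < ⋯ < s_{a+1}, i.e. with λ(E) interlacing λ(S).  Such a row weighs
-- x^{|λ(S)|-|λ(E)|} times powers of y and q read off from S and E, so by induction on a the weighted count becomes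
-- Σ_{μ ≺ λ(S)} q^{(a+1)(|λ(S)|-|μ|)} s_μ(q,…,q^a), which is s_{λ(S)}(q,…,q^{a+1}) by the branching rule for Schur
-- polynomials (delete the entries a+1 of a semistandard tableau).

module Submission where

open import Defs
open import Level using (Level)
open import Algebra.Bundles using (CommutativeRing)
open import Data.Bool using (Bool; true; false; T; not; _∧_; if_then_else_) renaming (_≟_ to _≟ᵇ_)
open import Data.Bool.Properties using (T-∧; T-≡; T-not-≡; ∧-identityʳ; ∧-zeroʳ)
open import Data.Bool.ListAction using (all)
open import Data.Empty using (⊥-elim)
open import Data.Unit using (⊤; tt)
open import Data.Nat using (ℕ; zero; suc; _+_; _*_; _∸_; _≤_; _<_; _≥_; _≤?_; z≤n; s≤s; _≡ᵇ_; _≤ᵇ_; _<ᵇ_; _≟_)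
import Data.Nat.Properties as ℕ
open import Data.Nat.ListAction using (sum)
open import Data.Nat.ListAction.Properties using (sum-++; sum-↭)
open import Data.Nat.Tactic.RingSolver using (solve-∀)
open import Data.List using (List; []; _∷_; [_]; _++_; _∷ʳ_; map; concatMap; cartesianProductWith; filter; filterᵇ; length;
  replicate; reverse; foldr; zip; upTo; applyUpTo)
open import Data.List.Properties using (map-∘; map-cong; map-++; length-map; length-++; length-replicate; length-upTo;
  length-reverse; map-applyUpTo; unfold-reverse; reverse-injective; ∷-injective; ++-identityʳ; length-filter; filter-all;
  filter-none; filter-accept; filter-++)
open import Data.List.Membership.Propositional using (_∈_)
open import Data.List.Membership.Propositional.Properties using (∈-++⁻; ∈-++⁺ˡ; ∈-++⁺ʳ; ∈-map⁺; ∈-map⁻; ∈-filter⁺;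
  ∈-filter⁻; ∈-upTo⁺; ∈-upTo⁻; ∈-applyUpTo⁺; ∈-applyUpTo⁻; ∈-∃++; ∈-cartesianProductWith⁺; ∈-cartesianProductWith⁻; ∈-concatMap⁺)
open import Data.List.Relation.Unary.Any using (here; there) renaming (map to Any-map)
open import Data.List.Relation.Unary.All using (All; []; _∷_)
import Data.List.Relation.Unary.All as All
import Data.List.Relation.Unary.All.Properties as Allₚ
open Allₚ using (all⁺; all⁻) renaming (map⁺ to All-map⁺)
open import Data.List.Relation.Unary.AllPairs using ([]; _∷_)
import Data.List.Relation.Unary.AllPairs as AllPairs
open import Data.List.Relation.Unary.Unique.Propositional using (Unique)
open import Data.List.Relation.Unary.Linked using (Linked; []; [-]; _∷_)
import Data.List.Relation.Unary.Linked as Linked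
import Data.List.Relation.Unary.Unique.Propositional.Properties as Unique
open import Data.List.Relation.Binary.Permutation.Propositional using (_↭_; ↭-refl; ↭-sym; ↭-trans; ↭-prep; ↭⇒↭ₛ; ↭⇒↭ₛ′)
open import Data.List.Relation.Binary.Permutation.Propositional.Properties using (∈-resp-↭; ↭-reverse;
  ↭-length) renaming (map⁺ to ↭-map⁺; shift to ↭-shift)
open import Data.Product using (_×_; _,_; proj₁; proj₂; ∃; ∃₂)
open import Data.Sum using (_⊎_; inj₁; inj₂)
open import Function using (_∘_; id; _⇔_; mk⇔; Equivalence; case_of_)
open import Relation.Binary.PropositionalEquality using (_≡_; _≢_; refl; sym; trans; cong; cong₂; subst; subst₂; module ≡-Reasoning)
import Relation.Binary.PropositionalEquality as ≡
open import Relation.Nullary using (¬_; yes; no; does; Dec)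
open import Relation.Nullary.Decidable using (T?)
open import Relation.Unary using (Decidable)

open import Data.Fin as Fin using (Fin)
open import Data.Vec using (Vec; lookup; toList)
import Data.Vec as Vec
open import Data.Vec.Properties using (length-toList)

private
  variable
    A B C : Set

T-∧-intro : ∀ {x y} → T x → T y → T (x ∧ y)
T-∧-intro p q = Equivalence.from T-∧ (p , q)

T-∧-fst : ∀ x {y} → T (x ∧ y) → T x
T-∧-fst true _ = tt

T-∧-snd : ∀ x {y} → T (x ∧ y) → T y
T-∧-snd true p = p

∈-range1⁺ : ∀ {n k} → 1 ≤ k → k ≤ n → k ∈ range1 n
∈-range1⁺ {k = suc k} _ k<n = ∈-map⁺ suc (∈-upTo⁺ k<n)

∈-range1⁻ : ∀ {n k} → k ∈ range1 n → 1 ≤ k × k ≤ n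
∈-range1⁻ k∈ with _ , j∈ , refl ← ∈-map⁻ suc k∈ = s≤s z≤n , ∈-upTo⁻ j∈

range1-suc : ∀ n → range1 (suc n) ≡ 1 ∷ map suc (range1 n)
range1-suc n = cong (1 ∷_) (begin
  map suc (applyUpTo suc n)          ≡⟨ map-applyUpTo suc suc n ⟩
  applyUpTo (suc ∘ suc) n            ≡⟨ map-applyUpTo id (suc ∘ suc) n ⟨
  map (suc ∘ suc) (upTo n)           ≡⟨ map-∘ (upTo n) ⟩
  map suc (map suc (upTo n))         ∎)
  where open ≡-Reasoning

length-range1 : ∀ n → length (range1 n) ≡ n
length-range1 n = trans (length-map suc (upTo n)) (length-upTo n)

range1-unique : ∀ n → Unique (range1 n)
range1-unique n = Unique.map⁺ ℕ.suc-injective (Unique.upTo⁺ n)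

sum-map-suc : ∀ xs → sum (map suc xs) ≡ length xs + sum xs
sum-map-suc [] = refl
sum-map-suc (x ∷ xs) = trans (cong (suc x +_) (sum-map-suc xs)) (rearrange x (length xs) (sum xs))
  where
  rearrange : ∀ x l s → suc x + (l + s) ≡ suc l + (x + s)
  rearrange = solve-∀

sum-range1 : ∀ n → sum (range1 n) ≡ choose2 (suc n)
sum-range1 zero = refl
sum-range1 (suc n) = begin
  sum (range1 (suc n))               ≡⟨ cong sum (range1-suc n) ⟩
  1 + sum (map suc (range1 n))       ≡⟨ cong suc (sum-map-suc (range1 n)) ⟩
  1 + (length (range1 n) + sum (range1 n)) ≡⟨ cong suc (cong₂ _+_ (length-range1 n) (sum-range1 n)) ⟩
  choose2 (suc (suc n))              ∎
  where open ≡-Reasoning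

WordOver : List A → ℕ → List A → Set
WordOver xs n r = length r ≡ n × All (_∈ xs) r

concatMap-map≡cartesianProductWith : ∀ (f : A → B → C) xs ys →
  concatMap (λ x → map (f x) ys) xs ≡ cartesianProductWith f xs ys
concatMap-map≡cartesianProductWith f [] ys = refl
concatMap-map≡cartesianProductWith f (x ∷ xs) ys =
  cong (map (f x) ys ++_) (concatMap-map≡cartesianProductWith f xs ys)

listsOf-cartesian : ∀ (xs : List A) n → listsOf xs (suc n) ≡ cartesianProductWith _∷_ xs (listsOf xs n)
listsOf-cartesian xs n = concatMap-map≡cartesianProductWith _∷_ xs (listsOf xs n)

∈-listsOf⁻ : ∀ (xs : List A) n {r} → r ∈ listsOf xs n → WordOver xs n r
∈-listsOf⁻ xs zero (here refl) = refl , []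
∈-listsOf⁻ xs (suc n) r∈ with x , r , x∈ , r∈ , refl ←
    ∈-cartesianProductWith⁻ _∷_ xs (listsOf xs n) (subst (_ ∈_) (listsOf-cartesian xs n) r∈)
  = let (len , r⊆) = ∈-listsOf⁻ xs n r∈ in cong suc len , x∈ ∷ r⊆

∈-listsOf⁺ : ∀ (xs : List A) n {r} → WordOver xs n r → r ∈ listsOf xs n
∈-listsOf⁺ xs zero {[]} (refl , []) = here refl
∈-listsOf⁺ xs (suc n) {x ∷ r} (refl , x∈ ∷ r⊆) =
  subst (_ ∈_) (sym (listsOf-cartesian xs n)) (∈-cartesianProductWith⁺ _∷_ x∈ (∈-listsOf⁺ xs n (refl , r⊆)))

listsOf-unique : ∀ {xs : List A} n → Unique xs → Unique (listsOf xs n)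
listsOf-unique zero _ = [] ∷ []
listsOf-unique {xs = xs} (suc n) u = subst Unique (sym (listsOf-cartesian xs n))
  (Unique.cartesianProductWith⁺ {xs = xs} {ys = listsOf xs n} _∷_ (λ { refl → refl , refl }) u (listsOf-unique n u))

data RowsOver (xs : List A) : List (List A) → List ℕ → Set where
  [] : RowsOver xs [] []
  _∷_ : ∀ {r rs l ls} → WordOver xs l r → RowsOver xs rs ls → RowsOver xs (r ∷ rs) (l ∷ ls)

rowFamilies-cartesian : ∀ (xs : List A) l ls →
  rowFamilies xs (l ∷ ls) ≡ cartesianProductWith _∷_ (listsOf xs l) (rowFamilies xs ls)
rowFamilies-cartesian xs l ls = concatMap-map≡cartesianProductWith _∷_ (listsOf xs l) (rowFamilies xs ls)

∈-rowFamilies⁻ : ∀ (xs : List A) ls {rs} → rs ∈ rowFamilies xs ls → RowsOver xs rs ls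
∈-rowFamilies⁻ xs [] (here refl) = []
∈-rowFamilies⁻ xs (l ∷ ls) rs∈ with r , rs , r∈ , rs∈ , refl ←
    ∈-cartesianProductWith⁻ _∷_ (listsOf xs l) (rowFamilies xs ls) (subst (_ ∈_) (rowFamilies-cartesian xs l ls) rs∈)
  = ∈-listsOf⁻ xs l r∈ ∷ ∈-rowFamilies⁻ xs ls rs∈

∈-rowFamilies⁺ : ∀ (xs : List A) ls {rs} → RowsOver xs rs ls → rs ∈ rowFamilies xs ls
∈-rowFamilies⁺ xs [] [] = here refl
∈-rowFamilies⁺ xs (l ∷ ls) (w ∷ ws) = subst (_ ∈_) (sym (rowFamilies-cartesian xs l ls))
  (∈-cartesianProductWith⁺ _∷_ (∈-listsOf⁺ xs l w) (∈-rowFamilies⁺ xs ls ws))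

rowFamilies-unique : ∀ {xs : List A} ls → Unique xs → Unique (rowFamilies xs ls)
rowFamilies-unique [] _ = [] ∷ []
rowFamilies-unique {xs = xs} (l ∷ ls) u = subst Unique (sym (rowFamilies-cartesian xs l ls))
  (Unique.cartesianProductWith⁺ {xs = listsOf xs l} {ys = rowFamilies xs ls} _∷_ (λ { refl → refl , refl })
    (listsOf-unique l u) (rowFamilies-unique ls u))

RowsOver-head : ∀ {xs : List A} {r rows l ls} → RowsOver xs (r ∷ rows) (l ∷ ls) → WordOver xs l r
RowsOver-head (w ∷ _) = w

RowsOver-tail : ∀ {xs : List A} {r rows l ls} → RowsOver xs (r ∷ rows) (l ∷ ls) → RowsOver xs rows ls
RowsOver-tail (_ ∷ ws) = ws

RowsOver-lengths : ∀ {xs : List A} {rs ls} → RowsOver xs rs ls → map length rs ≡ ls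
RowsOver-lengths [] = refl
RowsOver-lengths ((len , _) ∷ ws) = cong₂ _∷_ len (RowsOver-lengths ws)

RowsOver-length : ∀ {xs : List A} {rs ls} → RowsOver xs rs ls → length rs ≡ length ls
RowsOver-length {rs = rs} ws = trans (sym (length-map length rs)) (cong length (RowsOver-lengths ws))

∈-filterᵇ⁻ : ∀ (p : A → Bool) {xs x} → x ∈ filterᵇ p xs → x ∈ xs × T (p x)
∈-filterᵇ⁻ p = ∈-filter⁻ (T? ∘ p)

∈-filterᵇ⁺ : ∀ (p : A → Bool) {xs x} → x ∈ xs → T (p x) → x ∈ filterᵇ p xs
∈-filterᵇ⁺ p = ∈-filter⁺ (T? ∘ p)

filterᵇ-unique : ∀ (p : A → Bool) {xs} → Unique xs → Unique (filterᵇ p xs)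
filterᵇ-unique p = Unique.filter⁺ (T? ∘ p)

module _ {A : Set} where
  open import Data.List.Relation.Binary.Permutation.Setoid.Properties (≡.setoid A)
    using (Unique-resp-↭)

  sameMembers⇒↭ : ∀ {xs ys : List A} → Unique xs → Unique ys →
    (∀ {z} → z ∈ xs → z ∈ ys) → (∀ {z} → z ∈ ys → z ∈ xs) → xs ↭ ys
  sameMembers⇒↭ {[]} {[]} _ _ _ _ = ↭-refl
  sameMembers⇒↭ {[]} {y ∷ ys} _ _ _ ys⊆ with () ← ys⊆ (here refl)
  sameMembers⇒↭ {x ∷ xs} {ys} (x∉xs ∷ uxs) uys xs⊆ ys⊆
    with ys₁ , ys₂ , refl ← ∈-∃++ (xs⊆ (here refl)) =
    ↭-trans (↭-prep x (sameMembers⇒↭ uxs uys′ xs⊆′ ys⊆′)) (↭-sym (↭-shift x ys₁ ys₂))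
    where
    x∷ys′-unique : Unique (x ∷ ys₁ ++ ys₂)
    x∷ys′-unique = Unique-resp-↭ (↭⇒↭ₛ (↭-shift x ys₁ ys₂)) uys
    x∉ys′ : All (x ≢_) (ys₁ ++ ys₂)
    x∉ys′ = AllPairs.head x∷ys′-unique
    uys′ : Unique (ys₁ ++ ys₂)
    uys′ = AllPairs.tail x∷ys′-unique
    xs⊆′ : ∀ {z} → z ∈ xs → z ∈ ys₁ ++ ys₂
    xs⊆′ z∈ with ∈-resp-↭ (↭-shift x ys₁ ys₂) (xs⊆ (there z∈))
    ... | here refl = ⊥-elim (All.lookup x∉xs z∈ refl)
    ... | there z∈′ = z∈′
    ys⊆′ : ∀ {z} → z ∈ ys₁ ++ ys₂ → z ∈ xs
    ys⊆′ z∈ with ys⊆ (∈-resp-↭ (↭-sym (↭-shift x ys₁ ys₂)) (there z∈))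
    ... | here refl = ⊥-elim (All.lookup x∉ys′ z∈ refl)
    ... | there z∈′ = z∈′

  map-unique-injectiveOn : ∀ (f : A → B) {xs} → Unique xs →
    (∀ {x y} → x ∈ xs → y ∈ xs → f x ≡ f y → x ≡ y) → Unique (map f xs)
  map-unique-injectiveOn f {[]} _ _ = []
  map-unique-injectiveOn f {x ∷ xs} (x∉ ∷ u) inj =
    All-map⁺ (All.tabulate λ y∈ fx≡fy → All.lookup x∉ y∈ (inj (here refl) (there y∈) fx≡fy))
    ∷ map-unique-injectiveOn f u (λ x∈ y∈ → inj (there x∈) (there y∈))

countᵇ-++ : ∀ (p : A → Bool) xs ys → countᵇ p (xs ++ ys) ≡ countᵇ p xs + countᵇ p ys
countᵇ-++ p [] ys = refl
countᵇ-++ p (x ∷ xs) ys with p x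
... | true = cong suc (countᵇ-++ p xs ys)
... | false = countᵇ-++ p xs ys

countᵇ-map : ∀ (p : B → Bool) (f : A → B) xs → countᵇ p (map f xs) ≡ countᵇ (p ∘ f) xs
countᵇ-map p f [] = refl
countᵇ-map p f (x ∷ xs) = cong (_ +_) (countᵇ-map p f xs)

countᵇ-cong : ∀ {p q : A → Bool} → (∀ x → p x ≡ q x) → ∀ xs → countᵇ p xs ≡ countᵇ q xs
countᵇ-cong p≗q [] = refl
countᵇ-cong p≗q (x ∷ xs) = cong₂ (λ b n → (if b then 1 else 0) + n) (p≗q x) (countᵇ-cong p≗q xs)

countᵇ-pos : ∀ (p : A → Bool) {xs x} → x ∈ xs → T (p x) → 1 ≤ countᵇ p xs
countᵇ-pos p {y ∷ xs} (here refl) px with p y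
... | true = s≤s z≤n
countᵇ-pos p {y ∷ xs} (there x∈) px with p y
... | true = s≤s z≤n
... | false = countᵇ-pos p x∈ px

countᵇ-zero : ∀ (p : A → Bool) xs → (∀ {x} → x ∈ xs → ¬ T (p x)) → countᵇ p xs ≡ 0
countᵇ-zero p [] _ = refl
countᵇ-zero p (y ∷ xs) ¬p with p y in eq
... | true = ⊥-elim (¬p (here refl) (subst T (sym eq) tt))
... | false = countᵇ-zero p xs (¬p ∘ there)

module RingSums {c ℓ : Level} (R : CommutativeRing c ℓ) where
  open CommutativeRing R renaming (_+_ to _+ᴿ_; _*_ to _·_; refl to ≈-refl; sym to ≈-sym; trans to ≈-trans)
  open import Relation.Binary.Reasoning.Setoid setoid
  import Data.List.Relation.Binary.Permutation.Setoid.Properties setoid as Perm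

  ∑ : (A → Carrier) → List A → Carrier
  ∑ f xs = sumR R (map f xs)

  ∑-++ : ∀ (f : A → Carrier) xs ys → ∑ f (xs ++ ys) ≈ ∑ f xs +ᴿ ∑ f ys
  ∑-++ f [] ys = ≈-sym (+-identityˡ _)
  ∑-++ f (x ∷ xs) ys = ≈-trans (+-congˡ (∑-++ f xs ys)) (≈-sym (+-assoc _ _ _))

  ∑-concatMap : ∀ (f : B → Carrier) (g : A → List B) xs → ∑ f (concatMap g xs) ≈ ∑ (∑ f ∘ g) xs
  ∑-concatMap f g [] = ≈-refl
  ∑-concatMap f g (x ∷ xs) = ≈-trans (∑-++ f (g x) (concatMap g xs)) (+-congˡ (∑-concatMap f g xs))

  ∑-filter : ∀ (f : A → Carrier) {P : A → Set} (P? : Decidable P) xs →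
    ∑ f (filter P? xs) ≈ ∑ (λ x → if does (P? x) then f x else 0#) xs
  ∑-filter f P? [] = ≈-refl
  ∑-filter f P? (x ∷ xs) with does (P? x)
  ... | true = +-congˡ (∑-filter f P? xs)
  ... | false = ≈-trans (∑-filter f P? xs) (≈-sym (+-identityˡ _))

  ∑-cong : ∀ {f g : A → Carrier} xs → (∀ {x} → x ∈ xs → f x ≈ g x) → ∑ f xs ≈ ∑ g xs
  ∑-cong [] f≈g = ≈-refl
  ∑-cong (x ∷ xs) f≈g = +-cong (f≈g (here refl)) (∑-cong xs (f≈g ∘ there))

  ∑-map : ∀ (f : B → Carrier) (g : A → B) xs → ∑ f (map g xs) ≈ ∑ (f ∘ g) xs
  ∑-map f g [] = ≈-refl
  ∑-map f g (x ∷ xs) = +-congˡ (∑-map f g xs)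

  ∑-zero : ∀ (xs : List A) → ∑ (λ _ → 0#) xs ≈ 0#
  ∑-zero [] = ≈-refl
  ∑-zero (_ ∷ xs) = ≈-trans (+-identityˡ _) (∑-zero xs)

  *-distribˡ-∑ : ∀ k (f : A → Carrier) xs → k · ∑ f xs ≈ ∑ (λ x → k · f x) xs
  *-distribˡ-∑ k f [] = zeroʳ k
  *-distribˡ-∑ k f (x ∷ xs) = ≈-trans (distribˡ k _ _) (+-congˡ (*-distribˡ-∑ k f xs))

  *-distribʳ-∑ : ∀ k (f : A → Carrier) xs → ∑ f xs · k ≈ ∑ (λ x → f x · k) xs
  *-distribʳ-∑ k f xs = ≈-trans (*-comm _ k) (≈-trans (*-distribˡ-∑ k f xs) (∑-cong xs (λ {x} _ → *-comm k (f x))))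

  ∑-↭ : ∀ (f : A → Carrier) {xs ys} → xs ↭ ys → ∑ f xs ≈ ∑ f ys
  ∑-↭ f xs↭ys = Perm.foldr-commMonoid +-isCommutativeMonoid (↭⇒↭ₛ′ isEquivalence (↭-map⁺ f xs↭ys))

  ∑-sameMembers : ∀ (f : A → Carrier) {xs ys} → Unique xs → Unique ys →
    (∀ {z} → z ∈ xs → z ∈ ys) → (∀ {z} → z ∈ ys → z ∈ xs) → ∑ f xs ≈ ∑ f ys
  ∑-sameMembers f uxs uys xs⊆ ys⊆ = ∑-↭ f (sameMembers⇒↭ uxs uys xs⊆ ys⊆)

  ∏-++ : ∀ (f : A → Carrier) xs ys → prodR R (map f (xs ++ ys)) ≈ prodR R (map f xs) · prodR R (map f ys)
  ∏-++ f [] ys = ≈-sym (*-identityˡ _)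
  ∏-++ f (x ∷ xs) ys = ≈-trans (*-congˡ (∏-++ f xs ys)) (≈-sym (*-assoc _ _ _))

  pow-+ : ∀ x m n → pow R x (m + n) ≈ pow R x m · pow R x n
  pow-+ x zero n = ≈-sym (*-identityˡ _)
  pow-+ x (suc m) n = ≈-trans (*-congˡ (pow-+ x m n)) (≈-sym (*-assoc _ _ _))

  pow-cong : ∀ x {m n} → m ≡ n → pow R x m ≈ pow R x n
  pow-cong x refl = ≈-refl

  ∏-pow : ∀ q ns → prodR R (map (pow R q) ns) ≈ pow R q (sum ns)
  ∏-pow q [] = ≈-refl
  ∏-pow q (n ∷ ns) = ≈-trans (*-congˡ (∏-pow q ns)) (≈-sym (pow-+ q n (sum ns)))

-- Lozenge tilings, row by row

numberFrom : ℕ → List A → List (ℕ × A)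
numberFrom k [] = []
numberFrom k (x ∷ xs) = (k , x) ∷ numberFrom (suc k) xs

zip-applyUpTo : ∀ (f : ℕ → ℕ) k → (∀ i → f i ≡ k + i) → (xs : List A) →
  zip (applyUpTo f (length xs)) xs ≡ numberFrom k xs
zip-applyUpTo f k f≗k+ [] = refl
zip-applyUpTo f k f≗k+ (x ∷ xs) =
  cong₂ (λ i ys → (i , x) ∷ ys) (trans (f≗k+ 0) (ℕ.+-identityʳ k))
    (zip-applyUpTo (f ∘ suc) (suc k) (λ i → trans (f≗k+ (suc i)) (ℕ.+-suc k i)) xs)

index1≡numberFrom : ∀ (xs : List A) → index1 xs ≡ numberFrom 1 xs
index1≡numberFrom xs = trans (cong (λ ns → zip ns xs) (map-applyUpTo id suc (length xs)))
  (zip-applyUpTo suc 1 (λ _ → refl) xs)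

rowLozenges : ℕ → ℕ → List Dir → List Lozenge
rowLozenges i k [] = []
rowLozenges i k (d ∷ r) = (i , k , d) ∷ rowLozenges i (suc k) r

lozengesFrom : ℕ → List (List Dir) → List Lozenge
lozengesFrom i [] = []
lozengesFrom i (r ∷ rs) = rowLozenges i 1 r ++ lozengesFrom (suc i) rs

lozengesOf≡lozengesFrom : ∀ rows → lozengesOf rows ≡ lozengesFrom 1 rows
lozengesOf≡lozengesFrom rows = trans (cong (concatMap _) (index1≡numberFrom rows))
  (rows≡ _ (λ i r → trans (cong (map _) (index1≡numberFrom r)) (row≡ i _ (λ _ _ → refl) 1 r)) 1 rows)
  where
  row≡ : ∀ i (F : ℕ × Dir → Lozenge) → (∀ j d → F (j , d) ≡ (i , j , d)) →
    ∀ k r → map F (numberFrom k r) ≡ rowLozenges i k r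
  row≡ i F F≗ k [] = refl
  row≡ i F F≗ k (d ∷ r) = cong₂ _∷_ (F≗ k d) (row≡ i F F≗ (suc k) r)
  rows≡ : (F : ℕ × List Dir → List Lozenge) → (∀ i r → F (i , r) ≡ rowLozenges i 1 r) →
    ∀ i rows → concatMap F (numberFrom i rows) ≡ lozengesFrom i rows
  rows≡ F F≗ i [] = refl
  rows≡ F F≗ i (r ∷ rs) = cong₂ _++_ (F≗ i r) (rows≡ F F≗ (suc i) rs)

raise : Lozenge → Lozenge
raise (i , j , d) = suc i , j , d

rowLozenges-raise : ∀ i k r → rowLozenges (suc i) k r ≡ map raise (rowLozenges i k r)
rowLozenges-raise i k [] = refl
rowLozenges-raise i k (d ∷ r) = cong (_ ∷_) (rowLozenges-raise i (suc k) r)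

lozengesFrom-raise : ∀ i rs → lozengesFrom (suc i) rs ≡ map raise (lozengesFrom i rs)
lozengesFrom-raise i [] = refl
lozengesFrom-raise i (r ∷ rs) =
  trans (cong₂ _++_ (rowLozenges-raise i 1 r) (lozengesFrom-raise (suc i) rs))
        (sym (map-++ raise (rowLozenges i 1 r) (lozengesFrom (suc i) rs)))

upRow-lozengesFrom : ∀ i rs → All (λ l → ∃ λ j → proj₁ (upOf l) ≡ suc j) (lozengesFrom (suc i) rs)
upRow-lozengesFrom i [] = []
upRow-lozengesFrom i (r ∷ rs) = Allₚ.++⁺ (upRow-row r 1) (upRow-lozengesFrom (suc i) rs)
  where
  upRow-row : ∀ r k → All (λ l → ∃ λ j → proj₁ (upOf l) ≡ suc j) (rowLozenges (suc i) k r)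
  upRow-row [] k = []
  upRow-row (rightTilt ∷ r) k = (i , refl) ∷ upRow-row r (suc k)
  upRow-row (leftTilt ∷ r) k = (i , refl) ∷ upRow-row r (suc k)
  upRow-row (vertical ∷ r) k = (suc i , refl) ∷ upRow-row r (suc k)

upInRegionᵇ : ℕ → ℕ → List ℕ → ℕ × ℕ → Bool
upInRegionᵇ a b S u = upInRegion a b S (proj₁ u) (proj₂ u)

InRegion : ℕ → ℕ → List ℕ → ℕ × ℕ → Set
InRegion a b S = T ∘ upInRegionᵇ a b S

coverCount : List Lozenge → ℕ × ℕ → ℕ
coverCount L u = countᵇ (λ l → upEq (upOf l) u) L

record Tiles (a b : ℕ) (S : List ℕ) (rows : List (List Dir)) : Set where
  field
    inside : All (InRegion a b S ∘ upOf) (lozengesFrom 1 rows)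
    coveredOnce : ∀ i k → InRegion a b S (i , k) → coverCount (lozengesFrom 1 rows) (i , k) ≡ 1

∈-upsOfRegion⁻ : ∀ a b S {i k} → (i , k) ∈ upsOfRegion a b S → InRegion a b S (i , k)
∈-upsOfRegion⁻ a b S u∈ = proj₂ (∈-filterᵇ⁻ (upInRegionᵇ a b S) {xs = allUps} u∈)
  where
  allUps : List (ℕ × ℕ)
  allUps = concatMap (λ i → map (λ k → i , k) (range1 (a + b + 1 ∸ i))) (range1 a)

∈-upsOfRegion⁺ : ∀ a b S i k → InRegion a b S (i , k) → (i , k) ∈ upsOfRegion a b S
∈-upsOfRegion⁺ a b S i k h =
  ∈-filterᵇ⁺ (upInRegionᵇ a b S) (∈-concatMap⁺ _ (Any-map (λ { refl → ∈-map⁺ _ (∈-range1⁺ 1≤k k≤) }) (∈-range1⁺ 1≤i i≤a))) h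
  where
  1≤i : 1 ≤ i
  1≤i = ℕ.≤ᵇ⇒≤ 1 i (T-∧-fst (1 ≤ᵇ i) h)
  i≤a : i ≤ a
  i≤a = ℕ.≤ᵇ⇒≤ i a (T-∧-fst (i ≤ᵇ a) (T-∧-snd (1 ≤ᵇ i) h))
  1≤k : 1 ≤ k
  1≤k = ℕ.≤ᵇ⇒≤ 1 k (T-∧-fst (1 ≤ᵇ k) (T-∧-snd (i ≤ᵇ a) (T-∧-snd (1 ≤ᵇ i) h)))
  k≤ : k ≤ a + b + 1 ∸ i
  k≤ = ℕ.≤ᵇ⇒≤ k _ (T-∧-fst (k ≤ᵇ (a + b + 1 ∸ i)) (T-∧-snd (1 ≤ᵇ k) (T-∧-snd (i ≤ᵇ a) (T-∧-snd (1 ≤ᵇ i) h))))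

isTiling⇔Tiles : ∀ a b S rows → T (isTiling a b S rows) ⇔ Tiles a b S rows
isTiling⇔Tiles a b S rows = mk⇔ to from
  where
  L≡ : lozengesOf rows ≡ lozengesFrom 1 rows
  L≡ = lozengesOf≡lozengesFrom rows
  coveredOnceᵇ : ℕ × ℕ → Bool
  coveredOnceᵇ u = coverCount (lozengesOf rows) u ≡ᵇ 1
  to : T (isTiling a b S rows) → Tiles a b S rows
  to h = record
    { inside = subst (All _) L≡ (all⁺ _ (lozengesOf rows) (T-∧-fst (all _ (lozengesOf rows)) h))
    ; coveredOnce = λ i k u∈ → subst (λ L → coverCount L (i , k) ≡ 1) L≡
        (ℕ.≡ᵇ⇒≡ _ 1 (All.lookup (all⁺ coveredOnceᵇ (upsOfRegion a b S) (T-∧-snd (all _ (lozengesOf rows)) h)) (∈-upsOfRegion⁺ a b S i k u∈)))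
    }
  from : Tiles a b S rows → T (isTiling a b S rows)
  from t = T-∧-intro (all⁻ _ (subst (All _) (sym L≡) (Tiles.inside t)))
    (all⁻ coveredOnceᵇ (All.tabulate λ { {i , k} u∈ → ℕ.≡⇒≡ᵇ _ 1
      (subst (λ L → coverCount L (i , k) ≡ 1) (sym L≡) (Tiles.coveredOnce t i k (∈-upsOfRegion⁻ a b S u∈))) }))

verticals : ℕ → List Dir → List ℕ
verticals k [] = []
verticals k (vertical ∷ r) = k ∷ verticals (suc k) r
verticals k (rightTilt ∷ r) = verticals (suc k) r
verticals k (leftTilt ∷ r) = verticals (suc k) r

≡ᵇ-refl : ∀ n → (n ≡ᵇ n) ≡ true
≡ᵇ-refl n = Equivalence.to T-≡ (ℕ.≡⇒≡ᵇ n n refl)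

≢⇒≡ᵇ-false : ∀ {m n} → m ≢ n → (m ≡ᵇ n) ≡ false
≢⇒≡ᵇ-false {m} {n} m≢n with m ≡ᵇ n in eq
... | true = ⊥-elim (m≢n (ℕ.≡ᵇ⇒≡ m n (subst T (sym eq) tt)))
... | false = refl

upEq⇒≡ : ∀ u v → T (upEq u v) → u ≡ v
upEq⇒≡ (i , k) (i′ , k′) h = cong₂ _,_ (ℕ.≡ᵇ⇒≡ i i′ (T-∧-fst (i ≡ᵇ i′) h)) (ℕ.≡ᵇ⇒≡ k k′ (T-∧-snd (i ≡ᵇ i′) h))

upEq-refl : ∀ u → T (upEq u u)
upEq-refl (i , k) rewrite ≡ᵇ-refl i | ≡ᵇ-refl k = tt

bottomRow-covers-no-higher : ∀ k r i k′ → coverCount (rowLozenges 1 k r) (suc (suc (suc i)) , k′) ≡ 0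
bottomRow-covers-no-higher k [] i k′ = refl
bottomRow-covers-no-higher k (rightTilt ∷ r) i k′ = bottomRow-covers-no-higher (suc k) r i k′
bottomRow-covers-no-higher k (leftTilt ∷ r) i k′ = bottomRow-covers-no-higher (suc k) r i k′
bottomRow-covers-no-higher k (vertical ∷ r) i k′ = bottomRow-covers-no-higher (suc k) r i k′

bottomRow-covers-second-before : ∀ k r k′ → k′ < k → coverCount (rowLozenges 1 k r) (2 , k′) ≡ 0
bottomRow-covers-second-before k [] k′ _ = refl
bottomRow-covers-second-before k (rightTilt ∷ r) k′ k′<k = bottomRow-covers-second-before (suc k) r k′ (ℕ.m<n⇒m<1+n k′<k)
bottomRow-covers-second-before k (leftTilt ∷ r) k′ k′<k = bottomRow-covers-second-before (suc k) r k′ (ℕ.m<n⇒m<1+n k′<k)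
bottomRow-covers-second-before k (vertical ∷ r) k′ k′<k rewrite ≢⇒≡ᵇ-false (ℕ.>⇒≢ k′<k) =
  bottomRow-covers-second-before (suc k) r k′ (ℕ.m<n⇒m<1+n k′<k)

bottomRow-covers-second : ∀ k r k′ → coverCount (rowLozenges 1 k r) (2 , k′) ≡ (if elemℕ k′ (verticals k r) then 1 else 0)
bottomRow-covers-second k [] k′ = refl
bottomRow-covers-second k (rightTilt ∷ r) k′ = bottomRow-covers-second (suc k) r k′
bottomRow-covers-second k (leftTilt ∷ r) k′ = bottomRow-covers-second (suc k) r k′
bottomRow-covers-second k (vertical ∷ r) k′ with k ≟ k′
... | yes refl rewrite ≡ᵇ-refl k | bottomRow-covers-second-before (suc k) r k ℕ.≤-refl = refl
... | no k≢k′ rewrite ≢⇒≡ᵇ-false k≢k′ | ≢⇒≡ᵇ-false (k≢k′ ∘ sym) = bottomRow-covers-second (suc k) r k′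

raised-covers : ∀ L i k′ → coverCount (map raise L) (suc i , k′) ≡ coverCount L (i , k′)
raised-covers L i k′ = trans (countᵇ-map _ raise L) (countᵇ-cong upEq-raise L)
  where
  upEq-raise : ∀ l → upEq (upOf (raise l)) (suc i , k′) ≡ upEq (upOf l) (i , k′)
  upEq-raise (_ , _ , rightTilt) = refl
  upEq-raise (_ , _ , leftTilt) = refl
  upEq-raise (_ , _ , vertical) = refl

raised-covers-no-bottom : ∀ rest k′ → coverCount (map raise (lozengesFrom 1 rest)) (1 , k′) ≡ 0
raised-covers-no-bottom rest k′ = trans (countᵇ-map _ raise (lozengesFrom 1 rest))
  (countᵇ-zero _ (lozengesFrom 1 rest) (λ {l} l∈ → not-bottom l (All.lookup (upRow-lozengesFrom 0 rest) l∈)))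
  where
  not-bottom : ∀ l → (∃ λ j → proj₁ (upOf l) ≡ suc j) → ¬ T (upEq (upOf (raise l)) (1 , k′))
  not-bottom (_ , _ , rightTilt) (_ , refl) ()
  not-bottom (_ , _ , leftTilt) (_ , refl) ()
  not-bottom (_ , _ , vertical) (_ , refl) ()

coverCount-split : ∀ r rest u → coverCount (lozengesFrom 1 (r ∷ rest)) u
  ≡ coverCount (rowLozenges 1 1 r) u + coverCount (map raise (lozengesFrom 1 rest)) u
coverCount-split r rest u = trans (countᵇ-++ _ (rowLozenges 1 1 r) (lozengesFrom 2 rest))
  (cong (λ L → coverCount (rowLozenges 1 1 r) u + countᵇ _ L) (lozengesFrom-raise 1 rest))

T-∧-not-last⇔ : ∀ p q r e → T (p ∧ (q ∧ (r ∧ not e))) ⇔ (T (p ∧ (q ∧ (r ∧ true))) × ¬ T e)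
T-∧-not-last⇔ p q r e = mk⇔ (to p q r e) (from p q r e)
  where
  to : ∀ p q r e → T (p ∧ (q ∧ (r ∧ not e))) → T (p ∧ (q ∧ (r ∧ true))) × ¬ T e
  to true true true false _ = tt , λ ()
  from : ∀ p q r e → T (p ∧ (q ∧ (r ∧ true))) × ¬ T e → T (p ∧ (q ∧ (r ∧ not e)))
  from true true true false _ = tt
  from true true true true (_ , ¬e) = ¬e tt

-- Row i+1 of SH_{a,b}(E) is row i+2 of SH_{a+1,b}(S); only its bottom row carries the dents E.
upper-region⇔ : ∀ a b S E i k →
  InRegion a b E (suc i , k) ⇔ (InRegion (suc a) b S (suc (suc i) , k) × (i ≡ 0 → ¬ T (elemℕ k E)))
upper-region⇔ a b S E zero k =
  mk⇔ (λ h → let (h′ , ¬e) = Equivalence.to bounds⇔ h in h′ , λ _ → ¬e)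
      (λ (h , ¬e) → Equivalence.from bounds⇔ (h , ¬e refl))
  where
  bounds⇔ = T-∧-not-last⇔ (1 ≤ᵇ a) (1 ≤ᵇ k) (k ≤ᵇ (a + b + 1 ∸ 1)) (elemℕ k E)
upper-region⇔ a b S E (suc i) k = mk⇔ (λ h → h , λ ()) proj₁

upOf-raise : ∀ l → upOf (raise l) ≡ (suc (proj₁ (upOf l)) , proj₂ (upOf l))
upOf-raise (_ , _ , rightTilt) = refl
upOf-raise (_ , _ , leftTilt) = refl
upOf-raise (_ , _ , vertical) = refl

record BottomRow (a b : ℕ) (S : List ℕ) (r : List Dir) : Set where
  field
    inside : All (InRegion (suc a) b S ∘ upOf) (rowLozenges 1 1 r)
    coveredOnce : ∀ k → InRegion (suc a) b S (1 , k) → coverCount (rowLozenges 1 1 r) (1 , k) ≡ 1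

module PeelBottomRow (a b : ℕ) (S : List ℕ) (r : List Dir) (rest : List (List Dir)) where
  E = verticals 1 r
  L₁ = rowLozenges 1 1 r
  L′ = lozengesFrom 1 rest

  covers-second-vertical : ∀ k → T (elemℕ k E) → coverCount L₁ (2 , k) ≡ 1
  covers-second-vertical k k∈E with elemℕ k E | bottomRow-covers-second 1 r k
  ... | true | eq = eq

  covers-second-other : ∀ k → ¬ T (elemℕ k E) → coverCount L₁ (2 , k) ≡ 0
  covers-second-other k k∉E with elemℕ k E | bottomRow-covers-second 1 r k
  ... | true | _ = ⊥-elim (k∉E tt)
  ... | false | eq = eq

  covers-upper : ∀ i k → (i ≡ 0 → ¬ T (elemℕ k E)) →
    coverCount (lozengesFrom 1 (r ∷ rest)) (suc (suc i) , k) ≡ coverCount L′ (suc i , k)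
  covers-upper i k k∉E = trans (coverCount-split r rest (suc (suc i) , k)) (cong₂ _+_ (bottom-part i k∉E) (raised-covers L′ (suc i) k))
    where
    bottom-part : ∀ i → (i ≡ 0 → ¬ T (elemℕ k E)) → coverCount L₁ (suc (suc i) , k) ≡ 0
    bottom-part zero k∉E = covers-second-other k (k∉E refl)
    bottom-part (suc i) _ = bottomRow-covers-no-higher 1 r i k

  covers-bottom : ∀ k → coverCount (lozengesFrom 1 (r ∷ rest)) (1 , k) ≡ coverCount L₁ (1 , k)
  covers-bottom k = trans (coverCount-split r rest (1 , k)) (trans (cong (_ +_) (raised-covers-no-bottom rest k)) (ℕ.+-identityʳ _))

  raise-inside : ∀ {l} → l ∈ L′ → InRegion a b E (upOf l) → InRegion (suc a) b S (upOf (raise l))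
  raise-inside {l} l∈ h with upOf l | upOf-raise l | All.lookup (upRow-lozengesFrom 0 rest) l∈
  ... | (_ , k) | eq | (j , refl) = subst (InRegion (suc a) b S) (sym eq) (proj₁ (Equivalence.to (upper-region⇔ a b S E j k) h))

  split : Tiles (suc a) b S (r ∷ rest) → BottomRow a b S r × Tiles a b E rest
  split t = bottom , upper
    where
    open Tiles t
    bottom : BottomRow a b S r
    bottom = record
      { inside = Allₚ.++⁻ˡ L₁ inside
      ; coveredOnce = λ k k∈ → trans (sym (covers-bottom k)) (coveredOnce 1 k k∈)
      }
    raised-inside : All (InRegion (suc a) b S ∘ upOf ∘ raise) L′
    raised-inside = Allₚ.map⁻ (subst (All _) (lozengesFrom-raise 1 rest) (Allₚ.++⁻ʳ L₁ inside))
    dent-uncovered : ∀ {l} → l ∈ L′ → ∀ {k} → upOf l ≡ (1 , k) → ¬ T (elemℕ k E)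
    dent-uncovered {l} l∈ {k} up≡ k∈E = ℕ.<-irrefl refl (begin-strict
      1
        <⟨ s≤s (countᵇ-pos _ l∈ (subst (λ u → T (upEq u (1 , k))) (sym up≡) (upEq-refl (1 , k)))) ⟩
      1 + coverCount L′ (1 , k)
        ≡⟨ cong (_+ _) (covers-second-vertical k k∈E) ⟨
      coverCount L₁ (2 , k) + coverCount L′ (1 , k)
        ≡⟨ cong (_ +_) (raised-covers L′ 1 k) ⟨
      coverCount L₁ (2 , k) + coverCount (map raise L′) (2 , k)
        ≡⟨ coverCount-split r rest (2 , k) ⟨
      coverCount (lozengesFrom 1 (r ∷ rest)) (2 , k)
        ≡⟨ coveredOnce 2 k (subst (InRegion (suc a) b S) (trans (upOf-raise l) (cong (λ u → suc (proj₁ u) , proj₂ u) up≡))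
                              (All.lookup raised-inside l∈)) ⟩
      1 ∎)
      where open ℕ.≤-Reasoning
    lower-inside : ∀ {l} → l ∈ L′ → InRegion a b E (upOf l)
    lower-inside {l} l∈ with upOf l in up≡ | upOf-raise l | All.lookup (upRow-lozengesFrom 0 rest) l∈ | All.lookup raised-inside l∈
    ... | (_ , k) | eq | (j , refl) | h = Equivalence.from (upper-region⇔ a b S E j k)
          (subst (InRegion (suc a) b S) eq h , λ { refl → dent-uncovered l∈ up≡ })
    upper : Tiles a b E rest
    upper = record
      { inside = All.tabulate lower-inside
      ; coveredOnce = λ where
          zero k ()
          (suc i) k h → let (h′ , k∉E) = Equivalence.to (upper-region⇔ a b S E i k) h in
            trans (sym (covers-upper i k k∉E)) (coveredOnce (suc (suc i)) k h′)
      }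

  join : BottomRow a b S r → Tiles a b E rest → Tiles (suc a) b S (r ∷ rest)
  join bottom upper = record
    { inside = Allₚ.++⁺ (BottomRow.inside bottom)
        (subst (All _) (sym (lozengesFrom-raise 1 rest)) (Allₚ.map⁺ (All.tabulate λ l∈ → raise-inside l∈ (All.lookup (Tiles.inside upper) l∈))))
    ; coveredOnce = covered
    }
    where
    dents-uncovered : ∀ k → T (elemℕ k E) → coverCount L′ (1 , k) ≡ 0
    dents-uncovered k k∈E = countᵇ-zero _ L′ λ {l} l∈ covers →
      proj₂ (Equivalence.to (upper-region⇔ a b S E 0 k)
        (subst (InRegion a b E) (upEq⇒≡ (upOf l) (1 , k) covers) (All.lookup (Tiles.inside upper) l∈))) refl k∈E
    covered : ∀ i k → InRegion (suc a) b S (i , k) → coverCount (lozengesFrom 1 (r ∷ rest)) (i , k) ≡ 1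
    covered zero k ()
    covered (suc zero) k h = trans (covers-bottom k) (BottomRow.coveredOnce bottom k h)
    covered (suc (suc zero)) k h with elemℕ k E in k∈E?
    ... | true = begin
      coverCount (lozengesFrom 1 (r ∷ rest)) (2 , k)            ≡⟨ coverCount-split r rest (2 , k) ⟩
      coverCount L₁ (2 , k) + coverCount (map raise L′) (2 , k) ≡⟨ cong₂ _+_ (covers-second-vertical k k∈E) (raised-covers L′ 1 k) ⟩
      1 + coverCount L′ (1 , k)                                 ≡⟨ cong suc (dents-uncovered k k∈E) ⟩
      1                                                         ∎
      where
      open ≡-Reasoning
      k∈E : T (elemℕ k E)
      k∈E = subst T (sym k∈E?) tt
    ... | false = trans (covers-upper 0 k k∉E) (Tiles.coveredOnce upper 1 k (Equivalence.from (upper-region⇔ a b S E 0 k) (h , k∉E)))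
      where
      k∉E : 0 ≡ 0 → ¬ T (elemℕ k E)
      k∉E _ = subst T k∈E?
    covered (suc (suc (suc i))) k h =
      trans (covers-upper (suc i) k (λ ())) (Tiles.coveredOnce upper (suc (suc i)) k (Equivalence.from (upper-region⇔ a b S E (suc i) k) (h , λ ())))

tiles-∷⇔ : ∀ a b S r rest → Tiles (suc a) b S (r ∷ rest) ⇔ (BottomRow a b S r × Tiles a b (verticals 1 r) rest)
tiles-∷⇔ a b S r rest = mk⇔ split (λ (bottom , upper) → join bottom upper)
  where open PeelBottomRow a b S r rest

T-injective : ∀ {x y} → (T x → T y) → (T y → T x) → x ≡ y
T-injective {false} {false} _ _ = refl
T-injective {false} {true} _ y⇒x = ⊥-elim (y⇒x tt)
T-injective {true} {false} x⇒y _ = ⊥-elim (x⇒y tt)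
T-injective {true} {true} _ _ = refl

candidates-suc : ∀ a b → candidates (suc a) b ≡ concatMap (λ r → map (r ∷_) (candidates a b)) (listsOf allDirs (a + b))
candidates-suc a b = cong (rowFamilies allDirs) (begin
  map (downCount (suc a) b) (range1 (suc a))                ≡⟨ cong (map (downCount (suc a) b)) (range1-suc a) ⟩
  a + b ∷ map (downCount (suc a) b) (map suc (range1 a))    ≡⟨ cong (a + b ∷_) (map-∘ (range1 a)) ⟨
  a + b ∷ map (downCount a b) (range1 a)                    ∎)
  where open ≡-Reasoning

isTiling-∷⇔ : ∀ a b S r rest → T (isTiling (suc a) b S (r ∷ rest)) ⇔ (BottomRow a b S r × T (isTiling a b (verticals 1 r) rest))
isTiling-∷⇔ a b S r rest = mk⇔
  (λ t → let (bottom , upper) = Equivalence.to (tiles-∷⇔ a b S r rest) (Equivalence.to (isTiling⇔Tiles _ _ _ _) t)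
         in bottom , Equivalence.from (isTiling⇔Tiles _ _ _ _) upper)
  (λ (bottom , t) → Equivalence.from (isTiling⇔Tiles _ _ _ _) (Equivalence.from (tiles-∷⇔ a b S r rest) (bottom , Equivalence.to (isTiling⇔Tiles _ _ _ _) t)))

map-lozengesFrom-raise : ∀ {ℓ} {B : Set ℓ} (f : Lozenge → B) → (∀ l → f (raise l) ≡ f l) → ∀ rest →
  map f (lozengesFrom 2 rest) ≡ map f (lozengesOf rest)
map-lozengesFrom-raise f f-raise rest = begin
  map f (lozengesFrom 2 rest)                ≡⟨ cong (map f) (lozengesFrom-raise 1 rest) ⟩
  map f (map raise (lozengesFrom 1 rest))    ≡⟨ map-∘ (lozengesFrom 1 rest) ⟨
  map (f ∘ raise) (lozengesFrom 1 rest)      ≡⟨ map-cong f-raise (lozengesFrom 1 rest) ⟩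
  map f (lozengesFrom 1 rest)                ≡⟨ cong (map f) (lozengesOf≡lozengesFrom rest) ⟨
  map f (lozengesOf rest)                    ∎
  where open ≡-Reasoning

module TilingSum {c ℓ : Level} (R : CommutativeRing c ℓ) (x y q : CommutativeRing.Carrier R) where
  open CommutativeRing R renaming (_+_ to _+ᴿ_; _*_ to _·_; refl to ≈-refl; sym to ≈-sym; trans to ≈-trans)
  open RingSums R
  open import Relation.Binary.Reasoning.Setoid setoid

  rowWeight : List Dir → Carrier
  rowWeight r = prodR R (map (lozengeWeight R x y q) (rowLozenges 1 1 r))

  tilingWeight-∷ : ∀ r rest → tilingWeight R x y q (r ∷ rest) ≈ rowWeight r · tilingWeight R x y q rest
  tilingWeight-∷ r rest = begin
    prodR R (map w (lozengesOf (r ∷ rest)))               ≡⟨ cong (prodR R ∘ map w) (lozengesOf≡lozengesFrom (r ∷ rest)) ⟩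
    prodR R (map w (rowLozenges 1 1 r ++ lozengesFrom 2 rest)) ≈⟨ ∏-++ w (rowLozenges 1 1 r) (lozengesFrom 2 rest) ⟩
    rowWeight r · prodR R (map w (lozengesFrom 2 rest))    ≡⟨ cong (λ ws → rowWeight r · prodR R ws) upper≡ ⟩
    rowWeight r · tilingWeight R x y q rest                ∎
    where
    w = lozengeWeight R x y q
    w-raise : ∀ l → w (raise l) ≡ w l
    w-raise (_ , _ , rightTilt) = refl
    w-raise (_ , _ , leftTilt) = refl
    w-raise (_ , _ , vertical) = refl
    upper≡ : map w (lozengesFrom 2 rest) ≡ map w (lozengesOf rest)
    upper≡ = map-lozengesFrom-raise w w-raise rest

  tilingTerm : ℕ → ℕ → List ℕ → List (List Dir) → Carrier
  tilingTerm a b S rows = if isTiling a b S rows then tilingWeight R x y q rows else 0#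

  weightedTilings≈∑ : ∀ a b S → weightedTilings R a b S x y q ≈ ∑ (tilingTerm a b S) (candidates a b)
  weightedTilings≈∑ a b S = ∑-filter (tilingWeight R x y q) (T? ∘ isTiling a b S) (candidates a b)

  tilingTerms-∷ : ∀ a b S {r} {P : Set} (p? : Dec P) → BottomRow a b S r ⇔ P →
    ∑ (tilingTerm (suc a) b S ∘ (r ∷_)) (candidates a b) ≈ (if does p? then rowWeight r · weightedTilings R a b (verticals 1 r) x y q else 0#)
  tilingTerms-∷ a b S {r} (yes p) bottom⇔ = begin
    ∑ (tilingTerm (suc a) b S ∘ (r ∷_)) (candidates a b)
      ≈⟨ ∑-cong (candidates a b) (λ {rest} _ → term-∷ rest) ⟩
    ∑ (λ rest → rowWeight r · tilingTerm a b E rest) (candidates a b)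
      ≈⟨ *-distribˡ-∑ (rowWeight r) (tilingTerm a b E) (candidates a b) ⟨
    rowWeight r · ∑ (tilingTerm a b E) (candidates a b)
      ≈⟨ *-congˡ (weightedTilings≈∑ a b E) ⟨
    rowWeight r · weightedTilings R a b E x y q ∎
    where
    E = verticals 1 r
    term-∷ : ∀ rest → tilingTerm (suc a) b S (r ∷ rest) ≈ rowWeight r · tilingTerm a b E rest
    term-∷ rest rewrite T-injective {isTiling (suc a) b S (r ∷ rest)} (proj₂ ∘ Equivalence.to (isTiling-∷⇔ a b S r rest))
                                      (λ t → Equivalence.from (isTiling-∷⇔ a b S r rest) (Equivalence.from bottom⇔ p , t))
      with isTiling a b E rest
    ... | true = tilingWeight-∷ r rest
    ... | false = ≈-sym (zeroʳ _)
  tilingTerms-∷ a b S {r} (no ¬p) bottom⇔ = ≈-trans (∑-cong (candidates a b) (λ {rest} _ → no-term rest)) (∑-zero (candidates a b))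
    where
    no-term : ∀ rest → tilingTerm (suc a) b S (r ∷ rest) ≈ 0#
    no-term rest rewrite T-injective {isTiling (suc a) b S (r ∷ rest)} {false}
                           (¬p ∘ Equivalence.to bottom⇔ ∘ proj₁ ∘ Equivalence.to (isTiling-∷⇔ a b S r rest)) (λ ()) = ≈-refl

  weightedTilings-suc : ∀ a b S {P : List Dir → Set} (P? : Decidable P) →
    (∀ {r} → length r ≡ a + b → BottomRow a b S r ⇔ P r) →
    weightedTilings R (suc a) b S x y q
      ≈ ∑ (λ r → rowWeight r · weightedTilings R a b (verticals 1 r) x y q) (filter P? (listsOf allDirs (a + b)))
  weightedTilings-suc a b S P? P⇔ = begin
    weightedTilings R (suc a) b S x y q
      ≈⟨ weightedTilings≈∑ (suc a) b S ⟩
    ∑ (tilingTerm (suc a) b S) (candidates (suc a) b)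
      ≡⟨ cong (∑ (tilingTerm (suc a) b S)) (candidates-suc a b) ⟩
    ∑ (tilingTerm (suc a) b S) (concatMap (λ r → map (r ∷_) (candidates a b)) rows)
      ≈⟨ ∑-concatMap (tilingTerm (suc a) b S) (λ r → map (r ∷_) (candidates a b)) rows ⟩
    ∑ (λ r → ∑ (tilingTerm (suc a) b S) (map (r ∷_) (candidates a b))) rows
      ≈⟨ ∑-cong rows (λ {r} r∈ → ≈-trans (∑-map (tilingTerm (suc a) b S) (r ∷_) (candidates a b))
                                   (tilingTerms-∷ a b S (P? r) (P⇔ (proj₁ (∈-listsOf⁻ allDirs (a + b) r∈))))) ⟩
    ∑ (λ r → if does (P? r) then G r else 0#) rows
      ≈⟨ ∑-filter G P? rows ⟨
    ∑ G (filter P? rows) ∎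
    where
    rows = listsOf allDirs (a + b)
    G : List Dir → Carrier
    G r = rowWeight r · weightedTilings R a b (verticals 1 r) x y q

-- The bottom row as a finite automaton

-- State c of `Accepts dent? c k r`: whether up-triangle k is already covered, by a left-tilting
-- lozenge on down-triangle k - 1.  Every up-triangle must be exactly one of covered or a dent.
data Accepts (dent? : ℕ → Bool) : Bool → ℕ → List Dir → Set where
  end   : ∀ {c k} → not c ≡ dent? k → Accepts dent? c k []
  right : ∀ {k r} → dent? k ≡ false → Accepts dent? false (suc k) r → Accepts dent? false k (rightTilt ∷ r)
  left  : ∀ {c k r} → not c ≡ dent? k → Accepts dent? true (suc k) r → Accepts dent? c k (leftTilt ∷ r)
  vert  : ∀ {c k r} → not c ≡ dent? k → Accepts dent? false (suc k) r → Accepts dent? c k (vertical ∷ r)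

coversNext : Dir → Bool
coversNext leftTilt = true
coversNext _ = false

coversHere : Dir → ℕ
coversHere rightTilt = 1
coversHere _ = 0

indicator : Bool → ℕ
indicator c = if c then 1 else 0

settled : ∀ {c d} → (c ≡ true → d ≡ false) → (d ≡ false → c ≡ true) → not c ≡ d
settled {false} {false} _ d⇒c with () ← d⇒c refl
settled {false} {true} _ _ = refl
settled {true} {false} _ _ = refl
settled {true} {true} c⇒d _ = sym (c⇒d refl)

bottomRow-covers-before : ∀ k r {k′} → k′ < k → coverCount (rowLozenges 1 k r) (1 , k′) ≡ 0
bottomRow-covers-before k [] _ = refl
bottomRow-covers-before k (rightTilt ∷ r) k′<k rewrite ≢⇒≡ᵇ-false (ℕ.>⇒≢ k′<k) = bottomRow-covers-before (suc k) r (ℕ.m<n⇒m<1+n k′<k)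
bottomRow-covers-before k (leftTilt ∷ r) k′<k rewrite ≢⇒≡ᵇ-false (ℕ.>⇒≢ (ℕ.m<n⇒m<1+n k′<k)) =
  bottomRow-covers-before (suc k) r (ℕ.m<n⇒m<1+n k′<k)
bottomRow-covers-before k (vertical ∷ r) k′<k = bottomRow-covers-before (suc k) r (ℕ.m<n⇒m<1+n k′<k)

module BottomRowAutomaton (a b : ℕ) (S : List ℕ) where
  N = a + b + 1

  dent? : ℕ → Bool
  dent? k = elemℕ k S

  bottom-region⇔ : ∀ k → InRegion (suc a) b S (1 , k) ⇔ (1 ≤ k × k ≤ N × dent? k ≡ false)
  bottom-region⇔ k = mk⇔
    (λ h → ℕ.≤ᵇ⇒≤ 1 k (T-∧-fst (1 ≤ᵇ k) h) , ℕ.≤ᵇ⇒≤ k N (T-∧-fst (k ≤ᵇ N) (T-∧-snd (1 ≤ᵇ k) h)) ,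
           Equivalence.to T-not-≡ (T-∧-snd (k ≤ᵇ N) (T-∧-snd (1 ≤ᵇ k) h)))
    (λ (1≤k , k≤N , undented) → T-∧-intro (ℕ.≤⇒≤ᵇ 1≤k) (T-∧-intro (ℕ.≤⇒≤ᵇ k≤N) (Equivalence.from T-not-≡ undented)))

  second-region⇒ : ∀ k → InRegion (suc a) b S (2 , k) → 1 ≤ a
  second-region⇒ k h = ℕ.≤ᵇ⇒≤ 1 a (T-∧-fst (1 ≤ᵇ a) h)

  second-region⇐ : ∀ k → 1 ≤ a → 1 ≤ k → k < N → InRegion (suc a) b S (2 , k)
  second-region⇐ k 1≤a 1≤k k<N = T-∧-intro (ℕ.≤⇒≤ᵇ 1≤a) (T-∧-intro (ℕ.≤⇒≤ᵇ 1≤k) (T-∧-intro (ℕ.≤⇒≤ᵇ k≤) tt))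
    where
    k≤ : k ≤ a + b + 1 ∸ 1
    k≤ = subst (k ≤_) (sym (ℕ.m+n∸n≡m (a + b) 1)) (ℕ.≤-pred (subst (suc k ≤_) (ℕ.+-comm (a + b) 1) k<N))

  pending : Bool → ℕ → ℕ → ℕ
  pending c k k′ = if c ∧ (k ≡ᵇ k′) then 1 else 0

  count-here : ∀ c k d r → pending c k k + coverCount (rowLozenges 1 k (d ∷ r)) (1 , k) ≡ indicator c + coversHere d
  count-here c k d r rewrite ≡ᵇ-refl k | ∧-identityʳ c | bottomRow-covers-before (suc k) r (ℕ.n<1+n k) = cong (indicator c +_) (at-k d)
    where
    at-k : ∀ d → (if upEq (upOf (1 , k , d)) (1 , k) then 1 else 0) + 0 ≡ coversHere d
    at-k rightTilt rewrite ≡ᵇ-refl k = refl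
    at-k leftTilt rewrite ≢⇒≡ᵇ-false (ℕ.1+n≢n {k}) = refl
    at-k vertical = refl

  count-later : ∀ c k d r {k′} → k < k′ →
    pending c k k′ + coverCount (rowLozenges 1 k (d ∷ r)) (1 , k′) ≡ pending (coversNext d) (suc k) k′ + coverCount (rowLozenges 1 (suc k) r) (1 , k′)
  count-later c k d r {k′} k<k′ rewrite ≢⇒≡ᵇ-false (ℕ.<⇒≢ k<k′) | ∧-zeroʳ c = later d
    where
    later : ∀ d → (if upEq (upOf (1 , k , d)) (1 , k′) then 1 else 0) + coverCount (rowLozenges 1 (suc k) r) (1 , k′)
      ≡ pending (coversNext d) (suc k) k′ + coverCount (rowLozenges 1 (suc k) r) (1 , k′)
    later rightTilt rewrite ≢⇒≡ᵇ-false (ℕ.<⇒≢ k<k′) = refl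
    later leftTilt = refl
    later vertical = refl

  record Suffix (c : Bool) (k : ℕ) (r : List Dir) : Set where
    field
      pendingUndented : c ≡ true → dent? k ≡ false
      inside : All (InRegion (suc a) b S ∘ upOf) (rowLozenges 1 k r)
      coveredOnce : ∀ {k′} → k ≤ k′ → k′ ≤ N → dent? k′ ≡ false → pending c k k′ + coverCount (rowLozenges 1 k r) (1 , k′) ≡ 1

  pending-here : ∀ c k → pending c k k ≡ indicator c
  pending-here c k rewrite ≡ᵇ-refl k | ∧-identityʳ c = refl

  indicator≡1 : ∀ {c} → indicator c + 0 ≡ 1 → c ≡ true
  indicator≡1 {true} _ = refl

  covered⇒undented : ∀ {c d} → not c ≡ d → c ≡ true → d ≡ false
  covered⇒undented refl refl = refl

  undented⇒covered : ∀ {c d} → not c ≡ d → d ≡ false → c ≡ true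
  undented⇒covered {true} _ _ = refl
  undented⇒covered {false} refl ()

  length-tail : ∀ {k} (r : List Dir) → k + suc (length r) ≡ N → suc k + length r ≡ N
  length-tail {k} r len = trans (sym (ℕ.+-suc k (length r))) len

  before-end : ∀ {k} (r : List Dir) → k + suc (length r) ≡ N → k < N
  before-end {k} r len = subst (k <_) len (ℕ.m<m+n k (s≤s z≤n))

  1≤a-of-vertical : ∀ {k r} → (a ≡ 0 → verticals k (vertical ∷ r) ≡ []) → 1 ≤ a
  1≤a-of-vertical flat = ℕ.n≢0⇒n>0 λ a≡0 → case flat a≡0 of λ ()

  suffix-tail : ∀ {c k d r} → Suffix c k (d ∷ r) → (coversNext d ≡ true → dent? (suc k) ≡ false) → Suffix (coversNext d) (suc k) r
  suffix-tail {c} {k} {d} {r} s undented = record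
    { pendingUndented = undented
    ; inside = All.tail (Suffix.inside s)
    ; coveredOnce = λ k<k′ k′≤N u → trans (sym (count-later c k d r k<k′)) (Suffix.coveredOnce s (ℕ.<⇒≤ k<k′) k′≤N u)
    }

  suffix-∷ : ∀ {c k d r} → (c ≡ true → dent? k ≡ false) → InRegion (suc a) b S (upOf (1 , k , d)) →
    (dent? k ≡ false → indicator c + coversHere d ≡ 1) → Suffix (coversNext d) (suc k) r → Suffix c k (d ∷ r)
  suffix-∷ {c} {k} {d} {r} pendingUndented head at-k s = record
    { pendingUndented = pendingUndented
    ; inside = head ∷ Suffix.inside s
    ; coveredOnce = covered
    }
    where
    covered : ∀ {k′} → k ≤ k′ → k′ ≤ N → dent? k′ ≡ false → pending c k k′ + coverCount (rowLozenges 1 k (d ∷ r)) (1 , k′) ≡ 1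
    covered k≤k′ k′≤N u with ℕ.m≤n⇒m<n∨m≡n k≤k′
    ... | inj₁ k<k′ = trans (count-later c k d r k<k′) (Suffix.coveredOnce s k<k′ k′≤N u)
    ... | inj₂ refl = trans (count-here c k d r) (at-k u)

  covered-unless-dent : ∀ {c k d r} → coversHere d ≡ 0 → Suffix c k (d ∷ r) → k ≤ N → dent? k ≡ false → c ≡ true
  covered-unless-dent {c} {k} {d} {r} notHere s k≤N u = indicator≡1 (begin
    indicator c + 0                                                ≡⟨ cong (indicator c +_) notHere ⟨
    indicator c + coversHere d                                     ≡⟨ count-here c k d r ⟨
    pending c k k + coverCount (rowLozenges 1 k (d ∷ r)) (1 , k)   ≡⟨ Suffix.coveredOnce s ℕ.≤-refl k≤N u ⟩
    1                                                              ∎)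
    where open ≡-Reasoning

  suffix⇒accepts : ∀ {c k} r → k + length r ≡ N → Suffix c k r → Accepts dent? c k r × (a ≡ 0 → verticals k r ≡ [])
  suffix⇒accepts {c} {k} [] k+0≡N s = end (settled (Suffix.pendingUndented s) covered) , λ _ → refl
    where
    covered : dent? k ≡ false → c ≡ true
    covered u = indicator≡1 (trans (cong (_+ 0) (sym (pending-here c k)))
      (Suffix.coveredOnce s ℕ.≤-refl (ℕ.≤-reflexive (trans (sym (ℕ.+-identityʳ k)) k+0≡N)) u))
  suffix⇒accepts {c} {k} (rightTilt ∷ r) len s
    with _ , k≤N , undented ← Equivalence.to (bottom-region⇔ k) (All.head (Suffix.inside s))
    with c | trans (sym (count-here c k rightTilt r)) (Suffix.coveredOnce s ℕ.≤-refl k≤N undented)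
  ... | true | ()
  ... | false | _ = let (acc , flat) = suffix⇒accepts r (length-tail r len) (suffix-tail s λ ()) in right undented acc , flat
  suffix⇒accepts {c} {k} (leftTilt ∷ r) len s
    with _ , _ , undented-next ← Equivalence.to (bottom-region⇔ (suc k)) (All.head (Suffix.inside s)) =
    let (acc , flat) = suffix⇒accepts r (length-tail r len) (suffix-tail s (λ _ → undented-next))
    in left (settled (Suffix.pendingUndented s) (covered-unless-dent refl s (ℕ.<⇒≤ (before-end r len)))) acc , flat
  suffix⇒accepts {c} {k} (vertical ∷ r) len s =
    let (acc , _) = suffix⇒accepts r (length-tail r len) (suffix-tail s λ ())
    in vert (settled (Suffix.pendingUndented s) (covered-unless-dent refl s (ℕ.<⇒≤ (before-end r len)))) acc ,
       λ a≡0 → ⊥-elim (ℕ.<⇒≢ (second-region⇒ k (All.head (Suffix.inside s))) (sym a≡0))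

  accepts⇒suffix : ∀ {c k r} → 1 ≤ k → k + length r ≡ N → Accepts dent? c k r → (a ≡ 0 → verticals k r ≡ []) → Suffix c k r
  accepts⇒suffix {c} {k} {[]} _ k+0≡N (end settled) _ = record
    { pendingUndented = covered⇒undented settled
    ; inside = []
    ; coveredOnce = covered
    }
    where
    covered : ∀ {k′} → k ≤ k′ → k′ ≤ N → dent? k′ ≡ false → pending c k k′ + 0 ≡ 1
    covered k≤k′ k′≤N u with ℕ.≤-antisym k≤k′ (subst (_ ≤_) (trans (sym k+0≡N) (ℕ.+-identityʳ k)) k′≤N)
    ... | refl rewrite pending-here c k | undented⇒covered settled u = refl
  accepts⇒suffix {k = k} {rightTilt ∷ r} 1≤k len (right undented acc) flat =
    suffix-∷ (λ ()) (Equivalence.from (bottom-region⇔ k) (1≤k , ℕ.<⇒≤ (before-end r len) , undented)) (λ _ → refl)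
      (accepts⇒suffix {r = r} (s≤s z≤n) (length-tail r len) acc flat)
  accepts⇒suffix {k = k} {leftTilt ∷ r} 1≤k len (left settled acc) flat =
    suffix-∷ (covered⇒undented settled) (Equivalence.from (bottom-region⇔ (suc k)) (s≤s z≤n , before-end r len , Suffix.pendingUndented tail refl))
      (λ u → cong (λ c → indicator c + 0) (undented⇒covered settled u)) tail
    where
    tail : Suffix true (suc k) r
    tail = accepts⇒suffix {r = r} (s≤s z≤n) (length-tail r len) acc flat
  accepts⇒suffix {k = k} {vertical ∷ r} 1≤k len (vert settled acc) flat =
    suffix-∷ (covered⇒undented settled) (second-region⇐ k (1≤a-of-vertical {r = r} flat) 1≤k (before-end r len))
      (λ u → cong (λ c → indicator c + 0) (undented⇒covered settled u))
      (accepts⇒suffix {r = r} (s≤s z≤n) (length-tail r len) acc λ a≡0 → ⊥-elim (ℕ.<⇒≢ (1≤a-of-vertical {r = r} flat) (sym a≡0)))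

  bottomRow⇔suffix : ∀ r → BottomRow a b S r ⇔ Suffix false 1 r
  bottomRow⇔suffix r = mk⇔
    (λ br → record
      { pendingUndented = λ ()
      ; inside = BottomRow.inside br
      ; coveredOnce = λ {k} 1≤k k≤N u → BottomRow.coveredOnce br k (Equivalence.from (bottom-region⇔ k) (1≤k , k≤N , u))
      })
    (λ s → record
      { inside = Suffix.inside s
      ; coveredOnce = λ k h → let (1≤k , k≤N , u) = Equivalence.to (bottom-region⇔ k) h in Suffix.coveredOnce s 1≤k k≤N u
      })

ValidBottomRow : ℕ → List ℕ → List Dir → Set
ValidBottomRow a S r = Accepts (λ k → elemℕ k S) false 1 r × (a ≡ 0 → verticals 1 r ≡ [])

bottomRow⇔valid : ∀ a b S {r} → length r ≡ a + b → BottomRow a b S r ⇔ ValidBottomRow a S r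
bottomRow⇔valid a b S {r} len = mk⇔
  (λ br → suffix⇒accepts r len′ (Equivalence.to (bottomRow⇔suffix r) br))
  (λ (acc , flat) → Equivalence.from (bottomRow⇔suffix r) (accepts⇒suffix (s≤s z≤n) len′ acc flat))
  where
  open BottomRowAutomaton a b S
  len′ : 1 + length r ≡ N
  len′ = trans (cong suc len) (ℕ.+-comm 1 (a + b))

accepts? : ∀ (dent? : ℕ → Bool) c k r → Dec (Accepts dent? c k r)
accepts? dent? c k [] with not c ≟ᵇ dent? k
... | yes settled = yes (end settled)
... | no unsettled = no λ { (end settled) → unsettled settled }
accepts? dent? true k (rightTilt ∷ r) = no λ ()
accepts? dent? false k (rightTilt ∷ r) with dent? k ≟ᵇ false | accepts? dent? false (suc k) r
... | yes undented | yes acc = yes (right undented acc)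
... | no dented | _ = no λ { (right undented _) → dented undented }
... | _ | no rejected = no λ { (right _ acc) → rejected acc }
accepts? dent? c k (leftTilt ∷ r) with not c ≟ᵇ dent? k | accepts? dent? true (suc k) r
... | yes settled | yes acc = yes (left settled acc)
... | no unsettled | _ = no λ { (left settled _) → unsettled settled }
... | _ | no rejected = no λ { (left _ acc) → rejected acc }
accepts? dent? c k (vertical ∷ r) with not c ≟ᵇ dent? k | accepts? dent? false (suc k) r
... | yes settled | yes acc = yes (vert settled acc)
... | no unsettled | _ = no λ { (vert settled _) → unsettled settled }
... | _ | no rejected = no λ { (vert _ acc) → rejected acc }

validBottomRow? : ∀ a S → Decidable (ValidBottomRow a S)
validBottomRow? a S r with accepts? (λ k → elemℕ k S) false 1 r
... | no rejected = no (rejected ∘ proj₁)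
... | yes acc with a | verticals 1 r
...   | suc _ | _ = yes (acc , λ ())
...   | zero | [] = yes (acc , λ _ → refl)
...   | zero | _ ∷ _ = no λ (_ , flat) → case flat refl of λ ()

-- Interlacing of the dents with the vertical lozenges

data Ascending : ℕ → List ℕ → Set where
  [] : ∀ {k} → Ascending k []
  _∷_ : ∀ {k s S} → k ≤ s → Ascending (suc s) S → Ascending k (s ∷ S)

ascending-weaken : ∀ {k m S} → m ≤ k → Ascending k S → Ascending m S
ascending-weaken _ [] = []
ascending-weaken m≤k (k≤s ∷ S↑) = ℕ.≤-trans m≤k k≤s ∷ S↑

ascending-step : ∀ {k S} → Ascending k S → (∃ λ S′ → S ≡ k ∷ S′ × Ascending (suc k) S′) ⊎ Ascending (suc k) S
ascending-step [] = inj₂ []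
ascending-step {k} {s ∷ S} (k≤s ∷ S↑) with k ≟ s
... | yes refl = inj₁ (S , refl , S↑)
... | no k≢s = inj₂ (ℕ.≤∧≢⇒< k≤s k≢s ∷ S↑)

ascending-bounded : ∀ {k S} → Ascending (suc k) S → All (_≤ k) S → S ≡ []
ascending-bounded [] _ = refl
ascending-bounded (k<s ∷ _) (s≤k ∷ _) = ⊥-elim (ℕ.<-irrefl refl (ℕ.<-≤-trans k<s s≤k))

ascending-≢∷ : ∀ {k S E} → Ascending (suc k) S → k ∷ E ≢ S
ascending-≢∷ (k<k ∷ _) refl = ℕ.<-irrefl refl k<k

ascending-lowerBound : ∀ {k S} → Ascending k S → All (k ≤_) S
ascending-lowerBound [] = []
ascending-lowerBound (k≤s ∷ S↑) = k≤s ∷ All.map (ℕ.≤-trans (ℕ.m≤n⇒m≤1+n k≤s)) (ascending-lowerBound S↑)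

ascending-unique : ∀ {k S} → Ascending k S → Unique S
ascending-unique [] = []
ascending-unique (_ ∷ S↑) = All.map (λ s<s′ → ℕ.<⇒≢ s<s′) (ascending-lowerBound S↑) ∷ ascending-unique S↑

elemℕ-head : ∀ k S → elemℕ k (k ∷ S) ≡ true
elemℕ-head k S rewrite ≡ᵇ-refl k = refl

elemℕ-tail : ∀ {k k′} S → k < k′ → elemℕ k′ (k ∷ S) ≡ elemℕ k′ S
elemℕ-tail S k<k′ rewrite ≢⇒≡ᵇ-false (ℕ.>⇒≢ k<k′) = refl

elemℕ-below : ∀ {m S} k → Ascending m S → k < m → elemℕ k S ≡ false
elemℕ-below k [] _ = refl
elemℕ-below k (m≤s ∷ S↑) k<m rewrite ≢⇒≡ᵇ-false (ℕ.<⇒≢ (ℕ.<-≤-trans k<m m≤s)) = elemℕ-below k S↑ (ℕ.<-trans k<m (s≤s m≤s))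

elemℕ⇒∈ : ∀ k S → T (elemℕ k S) → k ∈ S
elemℕ⇒∈ k (s ∷ S) h with k ≡ᵇ s in eq
... | true = here (ℕ.≡ᵇ⇒≡ k s (subst T (sym eq) tt))
... | false = there (elemℕ⇒∈ k S h)

∈⇒elemℕ : ∀ k S → k ∈ S → T (elemℕ k S)
∈⇒elemℕ k (s ∷ S) (here refl) rewrite ≡ᵇ-refl k = tt
∈⇒elemℕ k (s ∷ S) (there k∈) with k ≡ᵇ s
... | true = tt
... | false = ∈⇒elemℕ k S k∈

verticals-ascending : ∀ k r → Ascending k (verticals k r)
verticals-ascending k [] = []
verticals-ascending k (rightTilt ∷ r) = ascending-weaken (ℕ.n≤1+n k) (verticals-ascending (suc k) r)
verticals-ascending k (leftTilt ∷ r) = ascending-weaken (ℕ.n≤1+n k) (verticals-ascending (suc k) r)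
verticals-ascending k (vertical ∷ r) = ℕ.≤-refl ∷ verticals-ascending (suc k) r

verticals-bounded : ∀ k r → All (_< k + length r) (verticals k r)
verticals-bounded k [] = []
verticals-bounded k (d ∷ r) = subst (λ n → All (_< n) (verticals k (d ∷ r))) (sym (ℕ.+-suc k (length r))) (bounded d)
  where
  bounded : ∀ d → All (_< suc k + length r) (verticals k (d ∷ r))
  bounded rightTilt = verticals-bounded (suc k) r
  bounded leftTilt = verticals-bounded (suc k) r
  bounded vertical = s≤s (ℕ.m≤m+n k (length r)) ∷ verticals-bounded (suc k) r

accepts-cong : ∀ {P Q : ℕ → Bool} {c k r} → (∀ {k′} → k ≤ k′ → P k′ ≡ Q k′) → Accepts P c k r → Accepts Q c k r
accepts-cong P≗Q (end settled) = end (trans settled (P≗Q ℕ.≤-refl))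
accepts-cong P≗Q (right undented acc) = right (trans (sym (P≗Q ℕ.≤-refl)) undented) (accepts-cong (P≗Q ∘ ℕ.<⇒≤) acc)
accepts-cong P≗Q (left settled acc) = left (trans settled (P≗Q ℕ.≤-refl)) (accepts-cong (P≗Q ∘ ℕ.<⇒≤) acc)
accepts-cong P≗Q (vert settled acc) = vert (trans settled (P≗Q ℕ.≤-refl)) (accepts-cong (P≗Q ∘ ℕ.<⇒≤) acc)

accepts-pastDent : ∀ {k} S {c r} → Accepts (λ k′ → elemℕ k′ (k ∷ S)) c (suc k) r ⇔ Accepts (λ k′ → elemℕ k′ S) c (suc k) r
accepts-pastDent {k} S = mk⇔ (accepts-cong (elemℕ-tail S)) (accepts-cong (sym ∘ elemℕ-tail S))

accepts-injective : ∀ {P c k r₁ r₂} → Accepts P c k r₁ → Accepts P c k r₂ →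
  length r₁ ≡ length r₂ → verticals k r₁ ≡ verticals k r₂ → r₁ ≡ r₂
accepts-injective (end _) (end _) _ _ = refl
accepts-injective (right _ acc₁) (right _ acc₂) len vs = cong (rightTilt ∷_) (accepts-injective acc₁ acc₂ (ℕ.suc-injective len) vs)
accepts-injective (left _ acc₁) (left _ acc₂) len vs = cong (leftTilt ∷_) (accepts-injective acc₁ acc₂ (ℕ.suc-injective len) vs)
accepts-injective (vert _ acc₁) (vert _ acc₂) len vs = cong (vertical ∷_) (accepts-injective acc₁ acc₂ (ℕ.suc-injective len) (proj₂ (∷-injective vs)))
accepts-injective (right undented _) (left settled _) _ _ with () ← trans settled undented
accepts-injective (right undented _) (vert settled _) _ _ with () ← trans settled undented
accepts-injective (left settled _) (right undented _) _ _ with () ← trans settled undented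
accepts-injective (vert settled _) (right undented _) _ _ with () ← trans settled undented
accepts-injective {k = k} {r₁ = _ ∷ r₁} (left _ _) (vert _ _) _ vs = ⊥-elim (ascending-≢∷ (verticals-ascending (suc k) r₁) (sym vs))
accepts-injective {k = k} {r₂ = _ ∷ r₂} (vert _ _) (left _ _) _ vs = ⊥-elim (ascending-≢∷ (verticals-ascending (suc k) r₂) vs)

HeadAtLeast : ℕ → List ℕ → Set
HeadAtLeast s [] = ⊤
HeadAtLeast s (e ∷ _) = s ≤ e

-- `Interlaced false S E`: s₁ ≤ e₁ < s₂ ≤ e₂ < ⋯ < sₙ;  `Interlaced true S E`: e₁ < s₁ ≤ e₂ < s₂ ≤ ⋯ ≤ eₙ < sₙ.
data Interlaced : Bool → List ℕ → List ℕ → Set where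
  [] : Interlaced true [] []
  vertical-first : ∀ {s S e E} → e < s → Interlaced false (s ∷ S) E → Interlaced true (s ∷ S) (e ∷ E)
  dent-first : ∀ {s S E} → HeadAtLeast s E → Interlaced true S E → Interlaced false (s ∷ S) E

rightTilts : List Dir → ℕ
rightTilts [] = 0
rightTilts (rightTilt ∷ r) = suc (rightTilts r)
rightTilts (_ ∷ r) = rightTilts r

leftTilts : List Dir → ℕ
leftTilts [] = 0
leftTilts (leftTilt ∷ r) = suc (leftTilts r)
leftTilts (_ ∷ r) = leftTilts r

tiltPositions : ℕ → List Dir → ℕ
tiltPositions k [] = 0
tiltPositions k (vertical ∷ r) = tiltPositions (suc k) r
tiltPositions k (_ ∷ r) = k + tiltPositions (suc k) r

ascending-headAtLeast : ∀ {k S} → Ascending (suc k) S → HeadAtLeast k S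
ascending-headAtLeast [] = tt
ascending-headAtLeast (k<s ∷ _) = ℕ.<⇒≤ k<s

ascending-raise : ∀ {k s E} → k < s → Ascending k E → HeadAtLeast s E → Ascending (suc k) E
ascending-raise k<s [] _ = []
ascending-raise k<s (_ ∷ E↑) s≤e = ℕ.<-≤-trans k<s s≤e ∷ E↑

ascending-below : ∀ {k E} → Ascending k E → All (_< k) E → E ≡ []
ascending-below [] _ = refl
ascending-below (k≤e ∷ _) (e<k ∷ _) = ⊥-elim (ℕ.<-irrefl refl (ℕ.<-≤-trans e<k k≤e))

module RowsOfWidth (N : ℕ) where

  record RowShape (c : Bool) (k : ℕ) (r : List Dir) (S : List ℕ) : Set where
    field
      interlaced : Interlaced c S (verticals k r)
      leftTilts-sum : leftTilts r + sum S + (if c then k else 0) ≡ N + sum (verticals k r)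
      verticals-length : length (verticals k r) + (if c then 0 else 1) ≡ length S

  width-tail : ∀ {k} (r : List Dir) → k + suc (length r) ≡ N → suc k + length r ≡ N
  width-tail {k} r len = trans (sym (ℕ.+-suc k (length r))) len

  shape-left-dent : ∀ {k r S} → RowShape true (suc k) r S → RowShape false k (leftTilt ∷ r) (k ∷ S)
  shape-left-dent {k} {r} {S} shape = record
    { interlaced = dent-first (ascending-headAtLeast (verticals-ascending (suc k) r)) interlaced
    ; leftTilts-sum = trans (shift (leftTilts r) (sum S) k) leftTilts-sum
    ; verticals-length = trans (ℕ.+-comm _ 1) (cong suc (trans (sym (ℕ.+-identityʳ _)) verticals-length))
    }
    where
    open RowShape shape
    shift : ∀ l s k → suc l + (k + s) + 0 ≡ l + s + suc k
    shift = solve-∀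

  shape-left-covered : ∀ {k r S} → RowShape true (suc k) r S → RowShape true k (leftTilt ∷ r) S
  shape-left-covered {k} {r} {S} shape = record
    { interlaced = interlaced
    ; leftTilts-sum = trans (shift (leftTilts r) (sum S) k) leftTilts-sum
    ; verticals-length = verticals-length
    }
    where
    open RowShape shape
    shift : ∀ l s k → suc l + s + k ≡ l + s + suc k
    shift = solve-∀

  shape-vertical-dent : ∀ {k r S} → Ascending (suc k) S → RowShape false (suc k) r S → RowShape false k (vertical ∷ r) (k ∷ S)
  shape-vertical-dent {k} {r} {S} (k<s ∷ _) record { interlaced = il@(dent-first _ _) ; leftTilts-sum = sums ; verticals-length = lengths } = record
    { interlaced = dent-first ℕ.≤-refl (vertical-first k<s il)
    ; leftTilts-sum = trans (shift (leftTilts r) (sum S) k) (trans (cong (_+ k) sums) (swap N (sum (verticals (suc k) r)) k))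
    ; verticals-length = cong suc lengths
    }
    where
    shift : ∀ l s k → l + (k + s) + 0 ≡ l + s + 0 + k
    shift = solve-∀
    swap : ∀ n e k → n + e + k ≡ n + (k + e)
    swap = solve-∀

  shape-vertical-covered : ∀ {k r S} → Ascending (suc k) S → RowShape false (suc k) r S → RowShape true k (vertical ∷ r) S
  shape-vertical-covered {k} {r} {S} (k<s ∷ _) record { interlaced = il@(dent-first _ _) ; leftTilts-sum = sums ; verticals-length = lengths } = record
    { interlaced = vertical-first k<s il
    ; leftTilts-sum = trans (shift (leftTilts r) (sum S) k) (trans (cong (_+ k) sums) (swap N (sum (verticals (suc k) r)) k))
    ; verticals-length = trans (ℕ.+-identityʳ _) (trans (ℕ.+-comm 1 _) lengths)
    }
    where
    shift : ∀ l s k → l + s + k ≡ l + s + 0 + k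
    shift = solve-∀
    swap : ∀ n e k → n + e + k ≡ n + (k + e)
    swap = solve-∀

  accepts⇒shape : ∀ {c k S} r → Ascending k S → All (_≤ N) S → k + length r ≡ N →
    Accepts (λ k′ → elemℕ k′ S) c k r → RowShape c k r S
  accepts⇒shape {c} {k} [] S↑ S≤N len (end settled) with trans (sym (ℕ.+-identityʳ k)) len
  ... | refl with ascending-step S↑
  ...   | inj₁ (S′ , refl , S′↑) rewrite ascending-bounded S′↑ (All.tail S≤N) | elemℕ-head k [] with c | settled
  ...     | false | _ = record { interlaced = dent-first tt [] ; leftTilts-sum = ℕ.+-identityʳ (k + 0) ; verticals-length = refl }
  ...     | true | ()
  accepts⇒shape {c} {k} [] S↑ S≤N len (end settled) | refl | inj₂ S↑′ rewrite ascending-bounded S↑′ S≤N with c | settled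
  ...     | true | _ = record { interlaced = [] ; leftTilts-sum = sym (ℕ.+-identityʳ k) ; verticals-length = refl }
  ...     | false | ()
  accepts⇒shape {k = k} (rightTilt ∷ r) S↑ S≤N len (right undented acc) with ascending-step S↑
  ... | inj₁ (S′ , refl , _) with () ← trans (sym (elemℕ-head k S′)) undented
  ... | inj₂ S↑′ = record { RowShape (accepts⇒shape r S↑′ S≤N (width-tail r len) acc) }
  accepts⇒shape {false} {k} (leftTilt ∷ r) S↑ S≤N len (left settled acc) with ascending-step S↑
  ... | inj₁ (S′ , refl , S′↑) = shape-left-dent (accepts⇒shape r S′↑ (All.tail S≤N) (width-tail r len) (Equivalence.to (accepts-pastDent S′) acc))
  ... | inj₂ S↑′ with () ← trans settled (elemℕ-below k S↑′ ℕ.≤-refl)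
  accepts⇒shape {true} {k} (leftTilt ∷ r) S↑ S≤N len (left settled acc) with ascending-step S↑
  ... | inj₁ (S′ , refl , _) with () ← trans settled (elemℕ-head k S′)
  ... | inj₂ S↑′ = shape-left-covered (accepts⇒shape r S↑′ S≤N (width-tail r len) acc)
  accepts⇒shape {false} {k} (vertical ∷ r) S↑ S≤N len (vert settled acc) with ascending-step S↑
  ... | inj₁ (S′ , refl , S′↑) =
    shape-vertical-dent S′↑ (accepts⇒shape r S′↑ (All.tail S≤N) (width-tail r len) (Equivalence.to (accepts-pastDent S′) acc))
  ... | inj₂ S↑′ with () ← trans settled (elemℕ-below k S↑′ ℕ.≤-refl)
  accepts⇒shape {true} {k} (vertical ∷ r) S↑ S≤N len (vert settled acc) with ascending-step S↑
  ... | inj₁ (S′ , refl , _) with () ← trans settled (elemℕ-head k S′)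
  ... | inj₂ S↑′ = shape-vertical-covered S↑′ (accepts⇒shape r S↑′ S≤N (width-tail r len) acc)

  RowFor : ℕ → Bool → ℕ → List ℕ → List ℕ → Set
  RowFor f c k S E = ∃ λ r → length r ≡ f × Accepts (λ k′ → elemℕ k′ S) c k r × verticals k r ≡ E

  interlaced⇒row : ∀ f {c k S E} → f + k ≡ N → Ascending k S → All (_≤ N) S → Ascending k E → All (_< N) E →
    Interlaced c S E → RowFor f c k S E
  interlaced⇒row zero refl S↑ S≤N E↑ E<N il with ascending-below E↑ E<N
  interlaced⇒row zero refl S↑ S≤N E↑ E<N [] | refl = [] , refl , end refl , refl
  interlaced⇒row zero {k = k} refl (k≤s ∷ _) (s≤k ∷ _) E↑ E<N (dent-first _ []) | refl
    with refl ← ℕ.≤-antisym k≤s s≤k = [] , refl , end (sym (elemℕ-head k [])) , refl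
  interlaced⇒row (suc f) {false} {k} {s ∷ S} len (k≤s ∷ S↑) S≤N E↑ E<N (dent-first s≤E il) with k ≟ s
  ... | no k≢s =
    let k<s = ℕ.≤∧≢⇒< k≤s k≢s
        (r , len′ , acc , vs) = interlaced⇒row f (trans (ℕ.+-suc f k) len) (k<s ∷ S↑) S≤N (ascending-raise k<s E↑ s≤E) E<N (dent-first s≤E il)
    in rightTilt ∷ r , cong suc len′ , right (elemℕ-below k (k<s ∷ S↑) ℕ.≤-refl) acc , vs
  interlaced⇒row (suc f) {false} {k} {k ∷ []} len (_ ∷ S↑) S≤N E↑ E<N (dent-first _ []) | yes refl =
    let (r , len′ , acc , vs) = interlaced⇒row f (trans (ℕ.+-suc f k) len) S↑ (All.tail S≤N) [] [] []
    in leftTilt ∷ r , cong suc len′ , left (sym (elemℕ-head k [])) (Equivalence.from (accepts-pastDent []) acc) , vs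
  interlaced⇒row (suc f) {false} {k} {k ∷ S} {e ∷ E} len (_ ∷ S↑) S≤N (k≤e ∷ E↑) (e<N ∷ E<N) (dent-first _ (vertical-first e<s il)) | yes refl
    with k ≟ e
  ... | yes refl =
    let (r , len′ , acc , vs) = interlaced⇒row f (trans (ℕ.+-suc f k) len) S↑ (All.tail S≤N) E↑ E<N il
    in vertical ∷ r , cong suc len′ , vert (sym (elemℕ-head k S)) (Equivalence.from (accepts-pastDent S) acc) , cong (k ∷_) vs
  ... | no k≢e =
    let (r , len′ , acc , vs) = interlaced⇒row f (trans (ℕ.+-suc f k) len) S↑ (All.tail S≤N) (ℕ.≤∧≢⇒< k≤e k≢e ∷ E↑) (e<N ∷ E<N) (vertical-first e<s il)
    in leftTilt ∷ r , cong suc len′ , left (sym (elemℕ-head k S)) (Equivalence.from (accepts-pastDent S) acc) , vs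
  interlaced⇒row (suc f) {true} {k} len S↑ S≤N E↑ E<N [] =
    let (r , len′ , acc , vs) = interlaced⇒row f (trans (ℕ.+-suc f k) len) [] [] [] [] []
    in leftTilt ∷ r , cong suc len′ , left refl acc , vs
  interlaced⇒row (suc f) {true} {k} {s ∷ S} {e ∷ E} len (k≤s ∷ S↑) S≤N (k≤e ∷ E↑) (e<N ∷ E<N) (vertical-first e<s il) with k ≟ e
  ... | yes refl =
    let (r , len′ , acc , vs) = interlaced⇒row f (trans (ℕ.+-suc f k) len) (e<s ∷ S↑) S≤N E↑ E<N il
    in vertical ∷ r , cong suc len′ , vert (sym (elemℕ-below k (e<s ∷ S↑) ℕ.≤-refl)) acc , cong (k ∷_) vs
  ... | no k≢e =
    let k<e = ℕ.≤∧≢⇒< k≤e k≢e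
        (r , len′ , acc , vs) = interlaced⇒row f (trans (ℕ.+-suc f k) len) (ℕ.<-trans k<e e<s ∷ S↑) S≤N (k<e ∷ E↑) (e<N ∷ E<N) (vertical-first e<s il)
    in leftTilt ∷ r , cong suc len′ , left (sym (elemℕ-below k (ℕ.<-trans k<e e<s ∷ S↑) ℕ.≤-refl)) acc , vs

-- Partitions λ(X) and their interlacing

offsets : ℕ → List ℕ → List ℕ
offsets k [] = []
offsets k (x ∷ xs) = x ∸ k ∷ offsets (suc k) xs

map-numberFrom-offsets : ∀ (F : ℕ × ℕ → ℕ) → (∀ i x → F (i , x) ≡ x ∸ i) → ∀ k xs → map F (numberFrom k xs) ≡ offsets k xs
map-numberFrom-offsets F F≗ k [] = refl
map-numberFrom-offsets F F≗ k (x ∷ xs) = cong₂ _∷_ (F≗ k x) (map-numberFrom-offsets F F≗ (suc k) xs)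

foldr-snoc≡reverse : ∀ (xs : List ℕ) → foldr (λ p acc → acc ++ [ p ]) [] xs ≡ reverse xs
foldr-snoc≡reverse [] = refl
foldr-snoc≡reverse (x ∷ xs) = trans (cong (_∷ʳ x) (foldr-snoc≡reverse xs)) (sym (unfold-reverse x xs))

lambdaOf≡reverse-offsets : ∀ xs → lambdaOf xs ≡ reverse (offsets 1 xs)
lambdaOf≡reverse-offsets xs = trans (foldr-snoc≡reverse (map _ (index1 xs)))
  (cong reverse (trans (cong (map _) (index1≡numberFrom xs)) (map-numberFrom-offsets _ (λ _ _ → refl) 1 xs)))

sumRminusI≡sum-offsets : ∀ a b S → sumRminusI a b S ≡ sum (offsets 1 (complementList a b S))
sumRminusI≡sum-offsets a b S = cong sum (trans (cong (map _) (index1≡numberFrom (complementList a b S))) (map-numberFrom-offsets _ (λ _ _ → refl) 1 _))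

length-offsets : ∀ k xs → length (offsets k xs) ≡ length xs
length-offsets k [] = refl
length-offsets k (x ∷ xs) = cong suc (length-offsets (suc k) xs)

length-lambdaOf : ∀ xs → length (lambdaOf xs) ≡ length xs
length-lambdaOf xs = trans (cong length (lambdaOf≡reverse-offsets xs)) (trans (length-reverse (offsets 1 xs)) (length-offsets 1 xs))

sum-lambdaOf : ∀ xs → sum (lambdaOf xs) ≡ sum (offsets 1 xs)
sum-lambdaOf xs = trans (cong sum (lambdaOf≡reverse-offsets xs)) (sum-↭ (↭-reverse (offsets 1 xs)))

sum-offsets : ∀ {k} S → Ascending k S → sum (offsets k S) + choose2 (k + length S) ≡ sum S + choose2 k
sum-offsets {k} [] _ = cong choose2 (ℕ.+-identityʳ k)
sum-offsets {k} (s ∷ S) (k≤s ∷ S↑) = begin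
  s ∸ k + sum (offsets (suc k) S) + choose2 (k + suc (length S))
    ≡⟨ cong (λ n → s ∸ k + sum (offsets (suc k) S) + choose2 n) (ℕ.+-suc k (length S)) ⟩
  s ∸ k + sum (offsets (suc k) S) + choose2 (suc k + length S)
    ≡⟨ ℕ.+-assoc (s ∸ k) _ _ ⟩
  s ∸ k + (sum (offsets (suc k) S) + choose2 (suc k + length S))
    ≡⟨ cong (s ∸ k +_) (sum-offsets S (ascending-weaken (s≤s k≤s) S↑)) ⟩
  s ∸ k + (sum S + (k + choose2 k))
    ≡⟨ regroup (s ∸ k) (sum S) k (choose2 k) ⟩
  s ∸ k + k + sum S + choose2 k
    ≡⟨ cong (λ n → n + sum S + choose2 k) (ℕ.m∸n+n≡m k≤s) ⟩
  s + sum S + choose2 k ∎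
  where
  open ≡-Reasoning
  regroup : ∀ a b c d → a + (b + (c + d)) ≡ a + c + b + d
  regroup = solve-∀

offsets-injective : ∀ {k S₁ S₂} → Ascending k S₁ → Ascending k S₂ → offsets k S₁ ≡ offsets k S₂ → S₁ ≡ S₂
offsets-injective [] [] _ = refl
offsets-injective {k} (k≤s₁ ∷ S₁↑) (k≤s₂ ∷ S₂↑) eq with ∷-injective eq
... | s₁∸k≡s₂∸k , rest = cong₂ _∷_
  (trans (sym (ℕ.m∸n+n≡m k≤s₁)) (trans (cong (_+ k) s₁∸k≡s₂∸k) (ℕ.m∸n+n≡m k≤s₂)))
  (offsets-injective (ascending-weaken (s≤s k≤s₁) S₁↑) (ascending-weaken (s≤s k≤s₂) S₂↑) rest)

∸-mono-< : ∀ k {e s} → k ≤ e → e < s → e ∸ k ≤ s ∸ suc k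
∸-mono-< zero {s = suc s} _ (s≤s e≤s) = e≤s
∸-mono-< (suc k) {suc e} {suc s} (s≤s k≤e) (s≤s e<s) = ∸-mono-< k k≤e e<s

Decreasing : List ℕ → Set
Decreasing = Linked _≥_

decreasing-snoc : ∀ X {x p} → Decreasing (X ∷ʳ x) → p ≤ x → Decreasing (X ∷ʳ x ∷ʳ p)
decreasing-snoc [] _ p≤x = p≤x ∷ [-]
decreasing-snoc (x₁ ∷ []) (x≤x₁ ∷ _) p≤x = x≤x₁ ∷ (p≤x ∷ [-])
decreasing-snoc (x₁ ∷ x₂ ∷ X) (x₂≤x₁ ∷ dec) p≤x = x₂≤x₁ ∷ decreasing-snoc (x₂ ∷ X) dec p≤x

reverse-offsets-∷∷ : ∀ k s₁ s₂ S →
  reverse (offsets k (s₁ ∷ s₂ ∷ S)) ≡ reverse (offsets (suc (suc k)) S) ∷ʳ (s₂ ∸ suc k) ∷ʳ (s₁ ∸ k)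
reverse-offsets-∷∷ k s₁ s₂ S = trans (unfold-reverse (s₁ ∸ k) (offsets (suc k) (s₂ ∷ S)))
  (cong (_∷ʳ (s₁ ∸ k)) (unfold-reverse (s₂ ∸ suc k) (offsets (suc (suc k)) S)))

reverse-offsets-decreasing : ∀ {k} S → Ascending k S → Decreasing (reverse (offsets k S))
reverse-offsets-decreasing [] _ = []
reverse-offsets-decreasing (s ∷ []) _ = [-]
reverse-offsets-decreasing {k} (s₁ ∷ s₂ ∷ S) (k≤s₁ ∷ S↑@(s₁<s₂ ∷ _)) = subst Decreasing (sym (reverse-offsets-∷∷ k s₁ s₂ S))
  (decreasing-snoc (reverse (offsets (suc (suc k)) S))
    (subst Decreasing (unfold-reverse (s₂ ∸ suc k) (offsets (suc (suc k)) S))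
      (reverse-offsets-decreasing (s₂ ∷ S) (ascending-weaken (s≤s k≤s₁) S↑)))
    (∸-mono-< k k≤s₁ s₁<s₂))

data _≺_ : List ℕ → List ℕ → Set where
  single : ∀ {l} → [] ≺ [ l ]
  cons : ∀ {l₁ l₂ ls m μ} → l₂ ≤ m → m ≤ l₁ → μ ≺ (l₂ ∷ ls) → (m ∷ μ) ≺ (l₁ ∷ l₂ ∷ ls)

≺-snoc : ∀ X {x p m μ} → μ ≺ (X ∷ʳ x) → p ≤ m → m ≤ x → (μ ∷ʳ m) ≺ (X ∷ʳ x ∷ʳ p)
≺-snoc [] single p≤m m≤x = cons p≤m m≤x single
≺-snoc (x₁ ∷ []) (cons l≤m m≤l single) p≤m m≤x = cons l≤m m≤l (cons p≤m m≤x single)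
≺-snoc (x₁ ∷ x₂ ∷ X) (cons l≤m m≤l μ≺) p≤m m≤x = cons l≤m m≤l (≺-snoc (x₂ ∷ X) μ≺ p≤m m≤x)

≺-unsnoc : ∀ X {x p μ} → μ ≺ (X ∷ʳ x ∷ʳ p) → ∃₂ λ ν m → μ ≡ ν ∷ʳ m × ν ≺ (X ∷ʳ x) × p ≤ m × m ≤ x
≺-unsnoc [] (cons p≤m m≤x single) = [] , _ , refl , single , p≤m , m≤x
≺-unsnoc (x₁ ∷ []) (cons l≤m m≤l (cons p≤m m≤x single)) = _ ∷ [] , _ , refl , cons l≤m m≤l single , p≤m , m≤x
≺-unsnoc (x₁ ∷ x₂ ∷ X) (cons l≤m m≤l μ≺) with ν , m , refl , ν≺ , p≤m , m≤x ← ≺-unsnoc (x₂ ∷ X) μ≺ =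
  _ ∷ ν , m , refl , cons l≤m m≤l ν≺ , p≤m , m≤x

interlaced-headAtLeast : ∀ {s S E} → Interlaced false (s ∷ S) E → HeadAtLeast s E
interlaced-headAtLeast (dent-first s≤E _) = s≤E

ascending-fromHead : ∀ {k s E} → Ascending k E → HeadAtLeast s E → Ascending s E
ascending-fromHead [] _ = []
ascending-fromHead (_ ∷ E↑) s≤e = s≤e ∷ E↑

interlaced⇒≺ : ∀ {k S E} → Ascending k S → Ascending k E → Interlaced false S E → reverse (offsets k E) ≺ reverse (offsets k S)
interlaced⇒≺ _ _ (dent-first _ []) = single
interlaced⇒≺ {k} {s ∷ s₂ ∷ S} {e ∷ E} (k≤s ∷ S↑) (k≤e ∷ E↑) (dent-first s≤e (vertical-first e<s₂ il)) =
  subst (_ ≺_) (sym (reverse-offsets-∷∷ k s s₂ S))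
    (subst (_≺ _) (sym (unfold-reverse (e ∸ k) (offsets (suc k) E)))
      (≺-snoc (reverse (offsets (suc (suc k)) S))
        (subst (_ ≺_) (unfold-reverse (s₂ ∸ suc k) (offsets (suc (suc k)) S))
          (interlaced⇒≺ (ascending-weaken (s≤s k≤s) S↑) (ascending-weaken (s≤s k≤e) E↑) il))
        (ℕ.∸-monoˡ-≤ k s≤e) (∸-mono-< k k≤e e<s₂)))

≺⇒interlaced : ∀ {k} S → Ascending k S → ∀ {μ} → μ ≺ reverse (offsets k S) →
  ∃ λ E → Ascending k E × Interlaced false S E × reverse (offsets k E) ≡ μ
≺⇒interlaced (s ∷ []) _ single = [] , [] , dent-first tt [] , refl
≺⇒interlaced {k} (s ∷ s₂ ∷ S) (k≤s ∷ S↑@(s<s₂ ∷ _)) μ≺ =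
  let (ν , m , μ≡ , ν≺ , s∸k≤m , m≤s₂∸) = ≺-unsnoc (reverse (offsets (suc (suc k)) S)) (subst (_ ≺_) (reverse-offsets-∷∷ k s s₂ S) μ≺)
      (E , E↑ , il , E↦ν) = ≺⇒interlaced (s₂ ∷ S) (ascending-weaken (s≤s k≤s) S↑)
                              (subst (ν ≺_) (sym (unfold-reverse (s₂ ∸ suc k) (offsets (suc (suc k)) S))) ν≺)
      s≤m+k : s ≤ m + k
      s≤m+k = subst (_≤ m + k) (ℕ.m∸n+n≡m k≤s) (ℕ.+-monoˡ-≤ k s∸k≤m)
      m+k<s₂ : m + k < s₂
      m+k<s₂ = subst (m + k <_) (ℕ.m∸n+n≡m (ℕ.≤-trans (s≤s k≤s) s<s₂))
        (subst (_≤ s₂ ∸ suc k + suc k) (ℕ.+-suc m k) (ℕ.+-monoˡ-≤ (suc k) m≤s₂∸))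
  in m + k ∷ E , ℕ.m≤n+m k m ∷ ascending-weaken m+k<s₂ (ascending-fromHead E↑ (interlaced-headAtLeast il)) ,
     dent-first s≤m+k (vertical-first m+k<s₂ il) ,
     (begin
       reverse (offsets k (m + k ∷ E))            ≡⟨ unfold-reverse (m + k ∸ k) (offsets (suc k) E) ⟩
       reverse (offsets (suc k) E) ∷ʳ (m + k ∸ k) ≡⟨ cong₂ _∷ʳ_ E↦ν (ℕ.m+n∸n≡m m k) ⟩
       ν ∷ʳ m                                     ≡⟨ μ≡ ⟨
       _                                          ∎)
  where open ≡-Reasoning

between : ℕ → ℕ → List ℕ
between lo hi = applyUpTo (lo +_) (suc hi ∸ lo)

∈-between⁺ : ∀ {lo hi m} → lo ≤ m → m ≤ hi → m ∈ between lo hi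
∈-between⁺ {lo} {hi} {m} lo≤m m≤hi = subst (_∈ between lo hi) (ℕ.m+[n∸m]≡n lo≤m)
  (∈-applyUpTo⁺ (lo +_) (ℕ.∸-monoˡ-< (s≤s m≤hi) lo≤m))

∈-between⁻ : ∀ {lo hi m} → m ∈ between lo hi → lo ≤ m × m ≤ hi
∈-between⁻ {lo} {hi} m∈ with i , i< , refl ← ∈-applyUpTo⁻ (lo +_) m∈ =
  ℕ.m≤m+n lo i , ℕ.≤-pred (subst (lo + i <_) (ℕ.m+[n∸m]≡n (ℕ.<⇒≤ lo<1+hi)) (ℕ.+-monoʳ-< lo i<))
  where
  lo<1+hi : lo < suc hi
  lo<1+hi = ℕ.m∸n≢0⇒n<m (λ eq → ℕ.n≮0 (subst (i <_) eq i<))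

between-unique : ∀ lo hi → Unique (between lo hi)
between-unique lo hi = Unique.applyUpTo⁺₁ (lo +_) (suc hi ∸ lo) (λ i<j _ → ℕ.<⇒≢ (ℕ.+-monoʳ-< lo i<j))

interlacing : List ℕ → List (List ℕ)
interlacing [] = []
interlacing (l ∷ []) = [ [] ]
interlacing (l₁ ∷ l₂ ∷ ls) = cartesianProductWith _∷_ (between l₂ l₁) (interlacing (l₂ ∷ ls))

∈-interlacing⁺ : ∀ {μ κ} → μ ≺ κ → μ ∈ interlacing κ
∈-interlacing⁺ single = here refl
∈-interlacing⁺ (cons l₂≤m m≤l₁ μ≺) = ∈-cartesianProductWith⁺ _∷_ (∈-between⁺ l₂≤m m≤l₁) (∈-interlacing⁺ μ≺)

∈-interlacing⁻ : ∀ κ {μ} → μ ∈ interlacing κ → μ ≺ κ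
∈-interlacing⁻ (l ∷ []) (here refl) = single
∈-interlacing⁻ (l₁ ∷ l₂ ∷ ls) μ∈ with m , μ , m∈ , μ∈ , refl ← ∈-cartesianProductWith⁻ _∷_ (between l₂ l₁) (interlacing (l₂ ∷ ls)) μ∈ =
  let (l₂≤m , m≤l₁) = ∈-between⁻ m∈ in cons l₂≤m m≤l₁ (∈-interlacing⁻ (l₂ ∷ ls) μ∈)

interlacing-unique : ∀ κ → Unique (interlacing κ)
interlacing-unique [] = []
interlacing-unique (l ∷ []) = [] ∷ []
interlacing-unique (l₁ ∷ l₂ ∷ ls) = Unique.cartesianProductWith⁺ {xs = between l₂ l₁} {ys = interlacing (l₂ ∷ ls)} _∷_
  (λ { refl → refl , refl }) (between-unique l₂ l₁) (interlacing-unique (l₂ ∷ ls))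

-- Semistandard tableaux and the branching rule

data ColumnStrict : List ℕ → List ℕ → Set where
  []ˡ : ∀ {ys} → ColumnStrict [] ys
  []ʳ : ∀ {x xs} → ColumnStrict (x ∷ xs) []
  _∷_ : ∀ {x y xs ys} → x < y → ColumnStrict xs ys → ColumnStrict (x ∷ xs) (y ∷ ys)

WeaklyIncreasing : List ℕ → Set
WeaklyIncreasing = Linked _≤_

weaklyIncr⇔ : ∀ r → T (weaklyIncr r) ⇔ WeaklyIncreasing r
weaklyIncr⇔ r = mk⇔ (to r) from
  where
  to : ∀ r → T (weaklyIncr r) → WeaklyIncreasing r
  to [] _ = []
  to (x ∷ []) _ = [-]
  to (x ∷ y ∷ xs) h = ℕ.≤ᵇ⇒≤ x y (T-∧-fst (x ≤ᵇ y) h) ∷ to (y ∷ xs) (T-∧-snd (x ≤ᵇ y) h)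
  from : ∀ {r} → WeaklyIncreasing r → T (weaklyIncr r)
  from [] = tt
  from [-] = tt
  from (x≤y ∷ inc) = T-∧-intro (ℕ.≤⇒≤ᵇ x≤y) (from inc)

colStrict⇔ : ∀ r r′ → T (colStrict r r′) ⇔ ColumnStrict r r′
colStrict⇔ r r′ = mk⇔ (to r r′) from
  where
  to : ∀ r r′ → T (colStrict r r′) → ColumnStrict r r′
  to [] _ _ = []ˡ
  to (x ∷ xs) [] _ = []ʳ
  to (x ∷ xs) (y ∷ ys) h = ℕ.<ᵇ⇒< x y (T-∧-fst (x <ᵇ y) h) ∷ to xs ys (T-∧-snd (x <ᵇ y) h)
  from : ∀ {r r′} → ColumnStrict r r′ → T (colStrict r r′)
  from []ˡ = tt
  from []ʳ = tt
  from (x<y ∷ cs) = T-∧-intro (ℕ.<⇒<ᵇ x<y) (from cs)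

columnsStrict⇔ : ∀ rows → T (columnsStrict rows) ⇔ Linked ColumnStrict rows
columnsStrict⇔ rows = mk⇔ (to rows) from
  where
  to : ∀ rows → T (columnsStrict rows) → Linked ColumnStrict rows
  to [] _ = []
  to (r ∷ []) _ = [-]
  to (r ∷ r′ ∷ rs) h = Equivalence.to (colStrict⇔ r r′) (T-∧-fst (colStrict r r′) h) ∷ to (r′ ∷ rs) (T-∧-snd (colStrict r r′) h)
  from : ∀ {rows} → Linked ColumnStrict rows → T (columnsStrict rows)
  from [] = tt
  from [-] = tt
  from (cs ∷ css) = T-∧-intro (Equivalence.from (colStrict⇔ _ _) cs) (from css)

record IsSSYT (κ : List ℕ) (n : ℕ) (rows : List (List ℕ)) : Set where
  field
    shape : RowsOver (range1 n) rows κ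
    rowsIncreasing : All WeaklyIncreasing rows
    columnsIncreasing : Linked ColumnStrict rows

∈-ssyt⇔ : ∀ κ n {rows} → rows ∈ ssyt κ n ⇔ IsSSYT κ n rows
∈-ssyt⇔ κ n {rows} = mk⇔
  (λ rows∈ → let (rows∈′ , h) = ∈-filterᵇ⁻ isSSYT rows∈ in record
    { shape = ∈-rowFamilies⁻ (range1 n) κ rows∈′
    ; rowsIncreasing = All.map (λ {r} → Equivalence.to (weaklyIncr⇔ r)) (all⁺ weaklyIncr rows (T-∧-fst (all weaklyIncr rows) h))
    ; columnsIncreasing = Equivalence.to (columnsStrict⇔ rows) (T-∧-snd (all weaklyIncr rows) h)
    })
  (λ t → ∈-filterᵇ⁺ isSSYT (∈-rowFamilies⁺ (range1 n) κ (IsSSYT.shape t))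
    (T-∧-intro (all⁻ weaklyIncr (All.map (λ {r} → Equivalence.from (weaklyIncr⇔ r)) (IsSSYT.rowsIncreasing t)))
               (Equivalence.from (columnsStrict⇔ rows) (IsSSYT.columnsIncreasing t))))

ssyt-unique : ∀ κ n → Unique (ssyt κ n)
ssyt-unique κ n = filterᵇ-unique isSSYT (rowFamilies-unique κ (range1-unique n))

entries : List (List ℕ) → List ℕ
entries = concatMap id

entries-bounded : ∀ {n rows κ} → RowsOver (range1 n) rows κ → All (λ v → 1 ≤ v × v ≤ n) (entries rows)
entries-bounded [] = []
entries-bounded ((_ , r⊆) ∷ rows) = Allₚ.++⁺ (All.map ∈-range1⁻ r⊆) (entries-bounded rows)

∈-range1⇔ : ∀ {n r} → All (_∈ range1 n) r ⇔ (All (1 ≤_) r × All (_≤ n) r)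
∈-range1⇔ = mk⇔
  (λ r⊆ → All.map (proj₁ ∘ ∈-range1⁻) r⊆ , All.map (proj₂ ∘ ∈-range1⁻) r⊆)
  (λ (lo , hi) → All.zipWith (λ (1≤v , v≤n) → ∈-range1⁺ 1≤v v≤n) (lo , hi))

atMost : ℕ → List ℕ → List ℕ
atMost n = filter (_≤? n)

atMost-bounded : ∀ n r → All (_≤ n) (atMost n r)
atMost-bounded n = Allₚ.all-filter (_≤? n)

atMost-replicate : ∀ n k → atMost n (replicate k (suc n)) ≡ []
atMost-replicate n k = filter-none (_≤? n) (Allₚ.replicate⁺ k ℕ.1+n≰n)

atMost-pad : ∀ n {r} k → All (_≤ n) r → atMost n (r ++ replicate k (suc n)) ≡ r
atMost-pad n {r} k r≤n = begin
  atMost n (r ++ replicate k (suc n))                  ≡⟨ filter-++ (_≤? n) r (replicate k (suc n)) ⟩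
  atMost n r ++ atMost n (replicate k (suc n))         ≡⟨ cong₂ _++_ (filter-all (_≤? n) r≤n) (atMost-replicate n k) ⟩
  r ++ []                                              ≡⟨ ++-identityʳ r ⟩
  r                                                    ∎
  where open ≡-Reasoning

weaklyIncreasing-top : ∀ n {x xs} → WeaklyIncreasing (x ∷ xs) → suc n ≤ x → All (_≤ suc n) (x ∷ xs) →
  x ∷ xs ≡ replicate (suc (length xs)) (suc n)
weaklyIncreasing-top n {xs = []} [-] n<x (x≤ ∷ []) = cong [_] (ℕ.≤-antisym x≤ n<x)
weaklyIncreasing-top n {xs = y ∷ xs} (x≤y ∷ inc) n<x (x≤ ∷ r≤) =
  cong₂ _∷_ (ℕ.≤-antisym x≤ n<x) (weaklyIncreasing-top n inc (ℕ.≤-trans n<x x≤y) r≤)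

weaklyIncreasing-split : ∀ n {r} → WeaklyIncreasing r → All (_≤ suc n) r →
  r ≡ atMost n r ++ replicate (length r ∸ length (atMost n r)) (suc n)
weaklyIncreasing-split n {[]} _ _ = refl
weaklyIncreasing-split n {x ∷ xs} inc (x≤ ∷ xs≤) = by-cases (x ≤? n)
  where
  by-cases : Dec (x ≤ n) → x ∷ xs ≡ atMost n (x ∷ xs) ++ replicate (length (x ∷ xs) ∸ length (atMost n (x ∷ xs))) (suc n)
  by-cases (yes x≤n) rewrite filter-accept (_≤? n) {xs = xs} x≤n =
    cong (x ∷_) (weaklyIncreasing-split n (Linked.tail inc) xs≤)
  by-cases (no x≰n) = trans top (sym (cong (λ ys → ys ++ replicate (suc (length xs) ∸ length ys) (suc n)) none))
    where
    top : x ∷ xs ≡ replicate (suc (length xs)) (suc n)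
    top = weaklyIncreasing-top n inc (ℕ.≰⇒> x≰n) (x≤ ∷ xs≤)
    none : atMost n (x ∷ xs) ≡ []
    none = trans (cong (atMost n) top) (atMost-replicate n (suc (length xs)))

weaklyIncreasing-prefix : ∀ xs {ys} → WeaklyIncreasing (xs ++ ys) → WeaklyIncreasing xs
weaklyIncreasing-prefix [] _ = []
weaklyIncreasing-prefix (x ∷ []) _ = [-]
weaklyIncreasing-prefix (x ∷ y ∷ xs) (x≤y ∷ inc) = x≤y ∷ weaklyIncreasing-prefix (y ∷ xs) inc

atMost-weaklyIncreasing : ∀ n {r} → WeaklyIncreasing r → All (_≤ suc n) r → WeaklyIncreasing (atMost n r)
atMost-weaklyIncreasing n {r} inc r≤ = weaklyIncreasing-prefix (atMost n r) (subst WeaklyIncreasing (weaklyIncreasing-split n inc r≤) inc)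

pad-weaklyIncreasing : ∀ n {r} k → WeaklyIncreasing r → All (_≤ n) r → WeaklyIncreasing (r ++ replicate k (suc n))
pad-weaklyIncreasing n {[]} zero _ _ = []
pad-weaklyIncreasing n {[]} (suc zero) _ _ = [-]
pad-weaklyIncreasing n {[]} (suc (suc k)) _ _ = ℕ.≤-refl ∷ pad-weaklyIncreasing n (suc k) [] []
pad-weaklyIncreasing n {x ∷ []} zero _ _ = [-]
pad-weaklyIncreasing n {x ∷ []} (suc k) _ (x≤n ∷ []) = ℕ.m≤n⇒m≤1+n x≤n ∷ pad-weaklyIncreasing n (suc k) [] []
pad-weaklyIncreasing n {x ∷ y ∷ xs} k (x≤y ∷ inc) (_ ∷ r≤n) = x≤y ∷ pad-weaklyIncreasing n k inc r≤n

columnStrict-[]ʳ : ∀ xs → ColumnStrict xs []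
columnStrict-[]ʳ [] = []ˡ
columnStrict-[]ʳ (_ ∷ _) = []ʳ

columnStrict-prefix : ∀ xs {xs′} ys {ys′} → ColumnStrict (xs ++ xs′) (ys ++ ys′) → ColumnStrict xs ys
columnStrict-prefix [] ys _ = []ˡ
columnStrict-prefix (x ∷ xs) [] _ = []ʳ
columnStrict-prefix (x ∷ xs) (y ∷ ys) (x<y ∷ cs) = x<y ∷ columnStrict-prefix xs ys cs

columnStrict-atMost-length : ∀ n {r₁ r₂} → ColumnStrict r₁ r₂ → length r₂ ≤ length r₁ → All (_≤ suc n) r₂ →
  length r₂ ≤ length (atMost n r₁)
columnStrict-atMost-length n {r₂ = []} _ _ _ = z≤n
columnStrict-atMost-length n {x ∷ xs} {y ∷ ys} (x<y ∷ cs) (s≤s len≤) (y≤ ∷ ys≤) =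
  subst (λ r → suc (length ys) ≤ length r) (sym (filter-accept (_≤? n) {xs = xs} (ℕ.≤-pred (ℕ.≤-trans x<y y≤))))
    (s≤s (columnStrict-atMost-length n cs len≤ ys≤))

columnStrict-pad : ∀ n {r₁ r₂} X k → ColumnStrict r₁ r₂ → All (_≤ n) r₁ → length r₂ + k ≤ length r₁ →
  ColumnStrict (r₁ ++ X) (r₂ ++ replicate k (suc n))
columnStrict-pad n {_} {y ∷ ys} X k (x<y ∷ cs) (_ ∷ r₁≤n) (s≤s len≤) = x<y ∷ columnStrict-pad n X k cs r₁≤n len≤
columnStrict-pad n {r₁} {[]} X zero _ _ _ = columnStrict-[]ʳ (r₁ ++ X)
columnStrict-pad n {x ∷ xs} {[]} X (suc k) _ (x≤n ∷ xs≤n) (s≤s len≤) = s≤s x≤n ∷ columnStrict-pad n X k (columnStrict-[]ʳ xs) xs≤n len≤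

atMost-columnStrict : ∀ n {r r′} → WeaklyIncreasing r → WeaklyIncreasing r′ → All (_≤ suc n) r → All (_≤ suc n) r′ →
  ColumnStrict r r′ → ColumnStrict (atMost n r) (atMost n r′)
atMost-columnStrict n {r} {r′} inc inc′ r≤ r′≤ r<r′ = columnStrict-prefix (atMost n r) (atMost n r′)
  (subst₂ ColumnStrict (weaklyIncreasing-split n inc r≤) (weaklyIncreasing-split n inc′ r′≤) r<r′)

atMost-word : ∀ {n l r} → WordOver (range1 (suc n)) l r → WordOver (range1 n) (length (atMost n r)) (atMost n r)
atMost-word {n} {r = r} (_ , r⊆) =
  refl , Equivalence.from ∈-range1⇔ (Allₚ.filter⁺ (_≤? n) (proj₁ (Equivalence.to ∈-range1⇔ r⊆)) , atMost-bounded n r)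

columnStrict-lowerBound : ∀ {m r₁ r₂} → ColumnStrict r₁ r₂ → length r₂ ≤ length r₁ → All (m ≤_) r₁ → All (suc m ≤_) r₂
columnStrict-lowerBound {r₂ = []} _ _ _ = []
columnStrict-lowerBound (x<y ∷ cs) (s≤s len≤) (m≤x ∷ m≤xs) = ℕ.≤-<-trans m≤x x<y ∷ columnStrict-lowerBound cs len≤ m≤xs

IsSSYT-tail : ∀ {l κ n r rows} → IsSSYT (l ∷ κ) n (r ∷ rows) → IsSSYT κ n rows
IsSSYT-tail t = record
  { shape = RowsOver-tail (IsSSYT.shape t)
  ; rowsIncreasing = All.tail (IsSSYT.rowsIncreasing t)
  ; columnsIncreasing = Linked.tail (IsSSYT.columnsIncreasing t)
  }

dependentPairs : List A → (A → List B) → List (A × B)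
dependentPairs xs g = concatMap (λ x → map (x ,_) (g x)) xs

∈-dependentPairs⁻ : ∀ xs (g : A → List B) {x y} → (x , y) ∈ dependentPairs xs g → x ∈ xs × y ∈ g x
∈-dependentPairs⁻ (z ∷ xs) g xy∈ with ∈-++⁻ (map (z ,_) (g z)) xy∈
... | inj₁ xy∈′ with _ , y∈ , refl ← ∈-map⁻ (z ,_) xy∈′ = here refl , y∈
... | inj₂ xy∈′ = let (x∈ , y∈) = ∈-dependentPairs⁻ xs g xy∈′ in there x∈ , y∈

∈-dependentPairs⁺ : ∀ xs (g : A → List B) {x y} → x ∈ xs → y ∈ g x → (x , y) ∈ dependentPairs xs g
∈-dependentPairs⁺ (z ∷ xs) g (here refl) y∈ = ∈-++⁺ˡ (∈-map⁺ (z ,_) y∈)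
∈-dependentPairs⁺ (z ∷ xs) g (there x∈) y∈ = ∈-++⁺ʳ (map (z ,_) (g z)) (∈-dependentPairs⁺ xs g x∈ y∈)

dependentPairs-unique : ∀ {xs} (g : A → List B) → Unique xs → (∀ x → Unique (g x)) → Unique (dependentPairs xs g)
dependentPairs-unique {xs = []} g _ _ = []
dependentPairs-unique {xs = x ∷ xs} g (x∉ ∷ uxs) ug =
  Unique.++⁺ (Unique.map⁺ (λ { refl → refl }) (ug x)) (dependentPairs-unique g uxs ug) disjoint
  where
  disjoint : ∀ {v} → ¬ (v ∈ map (x ,_) (g x) × v ∈ dependentPairs xs g)
  disjoint (v∈₁ , v∈₂) with _ , _ , refl ← ∈-map⁻ (x ,_) v∈₁ = All.lookup x∉ (proj₁ (∈-dependentPairs⁻ xs g v∈₂)) refl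

FirstRowAtLeast : ℕ → List (List ℕ) → Set
FirstRowAtLeast t [] = ⊤
FirstRowAtLeast t (r ∷ _) = All (t ≤_) r

-- In a tableau of n + 1 rows with entries ≤ n + 1 the last row holds only n + 1's; deleting all the n + 1's
-- leaves a tableau whose shape interlaces the original one, and `extend` undoes this.
module Branching (n : ℕ) where

  pad : ℕ → List ℕ → List ℕ
  pad l r = r ++ replicate (l ∸ length r) (suc n)

  restrict : List (List ℕ) → List (List ℕ)
  restrict [] = []
  restrict (r ∷ []) = []
  restrict (r ∷ r′ ∷ rs) = atMost n r ∷ restrict (r′ ∷ rs)

  extend : List ℕ → List (List ℕ) → List (List ℕ)
  extend [] _ = []
  extend (l ∷ []) _ = replicate l (suc n) ∷ []
  extend (l ∷ l₂ ∷ κ) [] = []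
  extend (l ∷ l₂ ∷ κ) (r ∷ rs) = pad l r ∷ extend (l₂ ∷ κ) rs

  shapeOf : List (List ℕ) → List ℕ
  shapeOf T = map length (restrict T)

  record Restriction (κ : List ℕ) (T : List (List ℕ)) : Set where
    field
      interlaces : shapeOf T ≺ κ
      restricted : IsSSYT (shapeOf T) n (restrict T)
      extend-restrict : T ≡ extend κ (restrict T)

  ≤1+n-entries : ∀ {r} → All (_∈ range1 (suc n)) r → All (_≤ suc n) r
  ≤1+n-entries = proj₂ ∘ Equivalence.to ∈-range1⇔

  restriction : ∀ t {κ T} → IsSSYT κ (suc n) T → Decreasing κ → FirstRowAtLeast t T → t + length T ≡ suc (suc n) → T ≢ [] →
    Restriction κ T
  restriction t {T = []} _ _ _ _ T≢[] = ⊥-elim (T≢[] refl)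
  restriction t {l ∷ []} {r ∷ []} ssyt _ t≤r len _ with refl ← ℕ.suc-injective (trans (ℕ.+-comm 1 t) len) = record
    { interlaces = single
    ; restricted = record { shape = [] ; rowsIncreasing = [] ; columnsIncreasing = [] }
    ; extend-restrict = cong [_] (trans (all-equal r (≤1+n-entries r⊆) t≤r) (cong (λ m → replicate m (suc n)) len-r))
    }
    where
    len-r : length r ≡ l
    len-r = proj₁ (RowsOver-head (IsSSYT.shape ssyt))
    r⊆ : All (_∈ range1 (suc n)) r
    r⊆ = proj₂ (RowsOver-head (IsSSYT.shape ssyt))
    all-equal : ∀ {c} r → All (_≤ c) r → All (c ≤_) r → r ≡ replicate (length r) c
    all-equal [] _ _ = refl
    all-equal (x ∷ r) (x≤c ∷ r≤c) (c≤x ∷ c≤r) = cong₂ _∷_ (ℕ.≤-antisym x≤c c≤x) (all-equal r r≤c c≤r)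
  restriction t {_ ∷ []} {_ ∷ _ ∷ _} ssyt _ _ _ _ with () ← RowsOver-length (IsSSYT.shape ssyt)
  restriction t {_ ∷ _ ∷ _} {_ ∷ []} ssyt _ _ _ _ with () ← RowsOver-length (IsSSYT.shape ssyt)
  restriction t {l ∷ l′ ∷ κ} {r ∷ r′ ∷ rs} ssyt (l′≤l ∷ dec) t≤r len _ = record
    { interlaces = cons l′≤m m≤l (Restriction.interlaces ih)
    ; restricted = record
        { shape = atMost-word (RowsOver-head (IsSSYT.shape ssyt)) ∷ IsSSYT.shape restricted
        ; rowsIncreasing = atMost-weaklyIncreasing n inc-r (≤1+n-entries r⊆) ∷ IsSSYT.rowsIncreasing restricted
        ; columnsIncreasing = link rs (IsSSYT.columnsIncreasing restricted)
        }
    ; extend-restrict = cong₂ _∷_ (trans split-r (cong (λ k → atMost n r ++ replicate (k ∸ m) (suc n)) len-r)) (Restriction.extend-restrict ih)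
    }
    where
    len-r : length r ≡ l
    len-r = proj₁ (RowsOver-head (IsSSYT.shape ssyt))
    r⊆ : All (_∈ range1 (suc n)) r
    r⊆ = proj₂ (RowsOver-head (IsSSYT.shape ssyt))
    len-r′ : length r′ ≡ l′
    len-r′ = proj₁ (RowsOver-head (IsSSYT.shape (IsSSYT-tail ssyt)))
    r′⊆ : All (_∈ range1 (suc n)) r′
    r′⊆ = proj₂ (RowsOver-head (IsSSYT.shape (IsSSYT-tail ssyt)))
    inc-r : WeaklyIncreasing r
    inc-r = All.head (IsSSYT.rowsIncreasing ssyt)
    inc-r′ : WeaklyIncreasing r′
    inc-r′ = All.head (All.tail (IsSSYT.rowsIncreasing ssyt))
    r<r′ : ColumnStrict r r′
    r<r′ = Linked.head (IsSSYT.columnsIncreasing ssyt)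
    m = length (atMost n r)
    r′≤r : length r′ ≤ length r
    r′≤r = subst₂ _≤_ (sym len-r′) (sym len-r) l′≤l
    ih : Restriction (l′ ∷ κ) (r′ ∷ rs)
    ih = restriction (suc t) (IsSSYT-tail ssyt) dec (columnStrict-lowerBound r<r′ r′≤r t≤r) (trans (sym (ℕ.+-suc t _)) len) (λ ())
    restricted : IsSSYT (shapeOf (r′ ∷ rs)) n (restrict (r′ ∷ rs))
    restricted = Restriction.restricted ih
    l′≤m : l′ ≤ m
    l′≤m = subst (_≤ m) len-r′ (columnStrict-atMost-length n r<r′ r′≤r (≤1+n-entries r′⊆))
    m≤l : m ≤ l
    m≤l = subst (m ≤_) len-r (length-filter (_≤? n) r)
    split-r : r ≡ atMost n r ++ replicate (length r ∸ m) (suc n)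
    split-r = weaklyIncreasing-split n inc-r (≤1+n-entries r⊆)
    link : ∀ rs → Linked ColumnStrict (restrict (r′ ∷ rs)) → Linked ColumnStrict (atMost n r ∷ restrict (r′ ∷ rs))
    link [] _ = [-]
    link (_ ∷ _) css = atMost-columnStrict n inc-r inc-r′ (≤1+n-entries r⊆) (≤1+n-entries r′⊆) r<r′ ∷ css

  record Extension (κ : List ℕ) (T : List (List ℕ)) : Set where
    field
      extended : IsSSYT κ (suc n) (extend κ T)
      restrict-extend : restrict (extend κ T) ≡ T

  top-entries : ∀ k → All (_∈ range1 (suc n)) (replicate k (suc n))
  top-entries k = Allₚ.replicate⁺ k (∈-range1⁺ (s≤s z≤n) ℕ.≤-refl)

  pad-word : ∀ {l m r} → WordOver (range1 n) m r → m ≤ l → WordOver (range1 (suc n)) l (pad l r)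
  pad-word {l} {r = r} (refl , r⊆) m≤l =
    trans (length-++ r) (trans (cong (length r +_) (length-replicate (l ∸ length r))) (ℕ.m+[n∸m]≡n m≤l)) ,
    Allₚ.++⁺ (All.map (λ v∈ → let (1≤v , v≤n) = ∈-range1⁻ v∈ in ∈-range1⁺ 1≤v (ℕ.m≤n⇒m≤1+n v≤n)) r⊆) (top-entries (l ∸ length r))

  entries-≤n : ∀ {m r} → WordOver (range1 n) m r → All (_≤ n) r
  entries-≤n (_ , r⊆) = All.map (proj₂ ∘ ∈-range1⁻) r⊆

  extension : ∀ {κ μ T} → μ ≺ κ → IsSSYT μ n T → Extension κ T
  extension {l ∷ []} {[]} {[]} single _ = record
    { extended = record
        { shape = (length-replicate l , top-entries l) ∷ []
        ; rowsIncreasing = pad-weaklyIncreasing n l [] [] ∷ []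
        ; columnsIncreasing = [-]
        }
    ; restrict-extend = refl
    }
  extension {μ = []} {_ ∷ _} _ ssyt with () ← RowsOver-length (IsSSYT.shape ssyt)
  extension {μ = _ ∷ _} {[]} _ ssyt with () ← RowsOver-length (IsSSYT.shape ssyt)
  extension {l₁ ∷ l₂ ∷ κ} {m ∷ μ} {r ∷ T} (cons l₂≤m m≤l₁ μ≺) ssyt = record
    { extended = record
        { shape = pad-word word-r m≤l₁ ∷ IsSSYT.shape extended
        ; rowsIncreasing = pad-weaklyIncreasing n (l₁ ∸ length r) (All.head (IsSSYT.rowsIncreasing ssyt)) r≤n ∷ IsSSYT.rowsIncreasing extended
        ; columnsIncreasing = link μ≺ T (IsSSYT.shape (IsSSYT-tail ssyt)) (IsSSYT.columnsIncreasing ssyt) (IsSSYT.columnsIncreasing extended)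
        }
    ; restrict-extend = restrict-pad μ≺ T (IsSSYT.shape (IsSSYT-tail ssyt)) restrict-extend
    }
    where
    open Extension (extension μ≺ (IsSSYT-tail ssyt))
    word-r : WordOver (range1 n) m r
    word-r = RowsOver-head (IsSSYT.shape ssyt)
    r≤n : All (_≤ n) r
    r≤n = entries-≤n word-r
    l₂≤r : l₂ ≤ length r
    l₂≤r = subst (l₂ ≤_) (sym (proj₁ word-r)) l₂≤m
    link : ∀ {κ μ} → μ ≺ (l₂ ∷ κ) → ∀ T → RowsOver (range1 n) T μ → Linked ColumnStrict (r ∷ T) →
      Linked ColumnStrict (extend (l₂ ∷ κ) T) → Linked ColumnStrict (pad l₁ r ∷ extend (l₂ ∷ κ) T)
    link single [] [] _ css = columnStrict-pad n _ l₂ (columnStrict-[]ʳ r) r≤n l₂≤r ∷ css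
    link (cons _ m₂≤l₂ _) (r₂ ∷ T) ((len₂ , _) ∷ _) (r<r₂ ∷ _) css =
      columnStrict-pad n _ (l₂ ∸ length r₂) r<r₂ r≤n (subst (_≤ length r) (sym (ℕ.m+[n∸m]≡n (subst (_≤ l₂) (sym len₂) m₂≤l₂))) l₂≤r) ∷ css
    restrict-pad : ∀ {κ μ} → μ ≺ (l₂ ∷ κ) → ∀ T → RowsOver (range1 n) T μ → restrict (extend (l₂ ∷ κ) T) ≡ T →
      restrict (pad l₁ r ∷ extend (l₂ ∷ κ) T) ≡ r ∷ T
    restrict-pad single [] [] _ = cong [_] (atMost-pad n (l₁ ∸ length r) r≤n)
    restrict-pad (cons _ _ _) (r₂ ∷ T) _ eq = cong₂ _∷_ (atMost-pad n (l₁ ∸ length r) r≤n) eq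

  sum-replicate : ∀ k c → sum (replicate k c) ≡ k * c
  sum-replicate zero c = refl
  sum-replicate (suc k) c = cong (c +_) (sum-replicate k c)

  extend-sum : ∀ {κ μ T} → μ ≺ κ → RowsOver (range1 n) T μ →
    sum (entries (extend κ T)) + suc n * sum μ ≡ sum (entries T) + suc n * sum κ
  extend-sum {l ∷ []} single [] = begin
    sum (replicate l (suc n) ++ []) + suc n * 0
      ≡⟨ cong (_+ suc n * 0) (trans (cong sum (++-identityʳ (replicate l (suc n)))) (sum-replicate l (suc n))) ⟩
    l * suc n + suc n * 0
      ≡⟨ rearrange l n ⟩
    0 + suc n * (l + 0) ∎
    where
    open ≡-Reasoning
    rearrange : ∀ l n → l * suc n + suc n * 0 ≡ 0 + suc n * (l + 0)
    rearrange = solve-∀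
  extend-sum {l₁ ∷ l₂ ∷ κ} {m ∷ μ} {r ∷ T} (cons _ m≤l₁ μ≺) ((len , _) ∷ words) = begin
    sum (pad l₁ r ++ entries E) + suc n * (m + sum μ)
      ≡⟨ cong (_+ suc n * (m + sum μ)) (trans (sum-++ (pad l₁ r) (entries E)) (cong (_+ sum (entries E)) (trans (sum-++ r _) (cong (sum r +_) (sum-replicate (l₁ ∸ length r) (suc n)))))) ⟩
    sum r + (l₁ ∸ length r) * suc n + sum (entries E) + suc n * (m + sum μ)
      ≡⟨ regroup (sum r) (l₁ ∸ length r) (sum (entries E)) n m (sum μ) ⟩
    sum r + (l₁ ∸ length r + m) * suc n + (sum (entries E) + suc n * sum μ)
      ≡⟨ cong₂ (λ u v → sum r + u * suc n + v) (trans (cong (l₁ ∸ length r +_) (sym len)) (ℕ.m∸n+n≡m (subst (_≤ l₁) (sym len) m≤l₁))) (extend-sum μ≺ words) ⟩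
    sum r + l₁ * suc n + (sum (entries T) + suc n * sum (l₂ ∷ κ))
      ≡⟨ collect (sum r) l₁ n (sum (entries T)) (sum (l₂ ∷ κ)) ⟩
    sum r + sum (entries T) + suc n * (l₁ + sum (l₂ ∷ κ))
      ≡⟨ cong (_+ suc n * (l₁ + sum (l₂ ∷ κ))) (sum-++ r (entries T)) ⟨
    sum (r ++ entries T) + suc n * (l₁ + sum (l₂ ∷ κ))
      ∎
    where
    open ≡-Reasoning
    E = extend (l₂ ∷ κ) T
    regroup : ∀ s k e n m M → s + k * suc n + e + suc n * (m + M) ≡ s + (k + m) * suc n + (e + suc n * M)
    regroup = solve-∀
    collect : ∀ s l n t L → s + l * suc n + (t + suc n * L) ≡ s + t + suc n * (l + L)
    collect = solve-∀

  ≺-sum : ∀ {μ κ} → μ ≺ κ → sum μ ≤ sum κ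
  ≺-sum single = z≤n
  ≺-sum {κ = l₁ ∷ l₂ ∷ κ} (cons _ m≤l μ≺) = ℕ.+-mono-≤ m≤l (≺-sum μ≺)

  restriction-weight : ∀ {κ T} → Restriction κ T → sum (entries T) ≡ sum (entries (restrict T)) + suc n * (sum κ ∸ sum (shapeOf T))
  restriction-weight {κ} {T} res = ℕ.+-cancelʳ-≡ (suc n * sum (shapeOf T)) _ _ (begin
    sum (entries T) + suc n * sum (shapeOf T)
      ≡⟨ cong (λ T′ → sum (entries T′) + suc n * sum (shapeOf T)) extend-restrict ⟩
    sum (entries (extend κ (restrict T))) + suc n * sum (shapeOf T)
      ≡⟨ extend-sum interlaces (IsSSYT.shape restricted) ⟩
    sum (entries (restrict T)) + suc n * sum κ
      ≡⟨ cong (λ s → sum (entries (restrict T)) + suc n * s) (ℕ.m+[n∸m]≡n (≺-sum interlaces)) ⟨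
    sum (entries (restrict T)) + suc n * (sum (shapeOf T) + (sum κ ∸ sum (shapeOf T)))
      ≡⟨ distribute (sum (entries (restrict T))) n (sum (shapeOf T)) (sum κ ∸ sum (shapeOf T)) ⟩
    sum (entries (restrict T)) + suc n * (sum κ ∸ sum (shapeOf T)) + suc n * sum (shapeOf T) ∎)
    where
    open Restriction res
    open ≡-Reasoning
    distribute : ∀ e n s d → e + suc n * (s + d) ≡ e + suc n * d + suc n * s
    distribute = solve-∀

  split : List (List ℕ) → List ℕ × List (List ℕ)
  split T = shapeOf T , restrict T

  module Splitting {κ} (dec : Decreasing κ) (len : length κ ≡ suc n) where
    restriction-of : ∀ {T} → T ∈ ssyt κ (suc n) → Restriction κ T
    restriction-of {T} T∈ = restriction 1 tableau dec (first-row T (IsSSYT.shape tableau)) (cong suc (trans (RowsOver-length (IsSSYT.shape tableau)) len)) nonempty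
      where
      tableau : IsSSYT κ (suc n) T
      tableau = Equivalence.to (∈-ssyt⇔ κ (suc n)) T∈
      first-row : ∀ T {ls} → RowsOver (range1 (suc n)) T ls → FirstRowAtLeast 1 T
      first-row [] _ = tt
      first-row (r ∷ _) ((_ , r⊆) ∷ _) = proj₁ (Equivalence.to ∈-range1⇔ r⊆)
      nonempty : T ≢ []
      nonempty refl with () ← trans (sym len) (sym (RowsOver-length (IsSSYT.shape tableau)))
    split-unique : Unique (map split (ssyt κ (suc n)))
    split-unique = map-unique-injectiveOn split (ssyt-unique κ (suc n)) λ {T} {T′} T∈ T′∈ eq →
      trans (Restriction.extend-restrict (restriction-of T∈))
        (trans (cong (extend κ ∘ proj₂) eq) (sym (Restriction.extend-restrict (restriction-of T′∈))))
    split⊆ : ∀ {z} → z ∈ map split (ssyt κ (suc n)) → z ∈ dependentPairs (interlacing κ) (λ μ → ssyt μ n)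
    split⊆ z∈ with T , T∈ , refl ← ∈-map⁻ split z∈ =
      ∈-dependentPairs⁺ (interlacing κ) (λ μ → ssyt μ n) (∈-interlacing⁺ interlaces) (Equivalence.from (∈-ssyt⇔ _ n) restricted)
      where open Restriction (restriction-of T∈)
    ⊆split : ∀ {z} → z ∈ dependentPairs (interlacing κ) (λ μ → ssyt μ n) → z ∈ map split (ssyt κ (suc n))
    ⊆split {μ , T} z∈ =
      let (μ∈ , T∈) = ∈-dependentPairs⁻ (interlacing κ) (λ μ → ssyt μ n) z∈
          μ≺ = ∈-interlacing⁻ κ μ∈
          tableau = Equivalence.to (∈-ssyt⇔ μ n) T∈
          open Extension (extension μ≺ tableau)
      in subst (_∈ map split (ssyt κ (suc n)))
           (cong₂ _,_ (trans (cong (map length) restrict-extend) (RowsOver-lengths (IsSSYT.shape tableau))) restrict-extend)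
           (∈-map⁺ split (Equivalence.from (∈-ssyt⇔ κ (suc n)) extended))

var-range1 : ∀ {c ℓ} (R : CommutativeRing c ℓ) (g : ℕ → CommutativeRing.Carrier R) m v → 1 ≤ v → v ≤ m →
  var R (map g (range1 m)) v ≡ g v
var-range1 R g (suc m) (suc zero) _ _ = refl
var-range1 R g (suc m) (suc (suc v)) _ (s≤s v≤m) =
  trans (cong (λ xs → var R xs (suc v)) shifted) (var-range1 R (g ∘ suc) m (suc v) (s≤s z≤n) v≤m)
  where
  shifted : map g (map suc (applyUpTo suc m)) ≡ map (g ∘ suc) (range1 m)
  shifted = begin
    map g (map suc (applyUpTo suc m))        ≡⟨ cong (map g) (map-applyUpTo suc suc m) ⟩
    map g (applyUpTo (suc ∘ suc) m)          ≡⟨ map-applyUpTo (suc ∘ suc) g m ⟩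
    applyUpTo (g ∘ suc ∘ suc) m              ≡⟨ map-applyUpTo suc (g ∘ suc) m ⟨
    map (g ∘ suc) (applyUpTo suc m)          ≡⟨ cong (map (g ∘ suc)) (map-applyUpTo id suc m) ⟨
    map (g ∘ suc) (range1 m)                 ∎
    where open ≡-Reasoning

module Schur {c ℓ : Level} (R : CommutativeRing c ℓ) (q : CommutativeRing.Carrier R) where
  open CommutativeRing R renaming (_+_ to _+ᴿ_; _*_ to _·_; refl to ≈-refl; sym to ≈-sym; trans to ≈-trans)
  open RingSums R
  open import Relation.Binary.Reasoning.Setoid setoid

  powers : ℕ → List Carrier
  powers m = map (pow R q) (range1 m)

  tableauWeight : List (List ℕ) → Carrier
  tableauWeight T = pow R q (sum (entries T))

  schur-powers : ∀ κ m → schur R κ (powers m) ≈ ∑ tableauWeight (ssyt κ m)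
  schur-powers κ m = begin
    schur R κ (powers m)
      ≡⟨ cong (λ k → ∑ (λ T → prodR R (map (var R (powers m)) (entries T))) (ssyt κ k)) length-powers ⟩
    ∑ (λ T → prodR R (map (var R (powers m)) (entries T))) (ssyt κ m)
      ≈⟨ ∑-cong (ssyt κ m) (λ {T} T∈ → ≈-trans (reflexive (cong (prodR R) (map-var (entries-bounded (IsSSYT.shape (Equivalence.to (∈-ssyt⇔ κ m) T∈)))))) (∏-pow q (entries T))) ⟩
    ∑ tableauWeight (ssyt κ m) ∎
    where
    length-powers : length (powers m) ≡ m
    length-powers = trans (length-map (pow R q) (range1 m)) (length-range1 m)
    map-var : ∀ {vs} → All (λ v → 1 ≤ v × v ≤ m) vs → map (var R (powers m)) vs ≡ map (pow R q) vs
    map-var [] = refl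
    map-var ((1≤v , v≤m) ∷ vs) = cong₂ _∷_ (var-range1 R (pow R q) m _ 1≤v v≤m) (map-var vs)

  schur-branching : ∀ n κ → Decreasing κ → length κ ≡ suc n →
    schur R κ (powers (suc n)) ≈ ∑ (λ μ → pow R q (suc n * (sum κ ∸ sum μ)) · schur R μ (powers n)) (interlacing κ)
  schur-branching n κ dec len = begin
    schur R κ (powers (suc n))
      ≈⟨ schur-powers κ (suc n) ⟩
    ∑ tableauWeight (ssyt κ (suc n))
      ≈⟨ ∑-cong (ssyt κ (suc n)) (λ {T} T∈ → reflexive (cong (pow R q) (restriction-weight (restriction-of T∈)))) ⟩
    ∑ (g ∘ split) (ssyt κ (suc n))
      ≈⟨ ∑-map g split (ssyt κ (suc n)) ⟨
    ∑ g (map split (ssyt κ (suc n)))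
      ≈⟨ ∑-sameMembers g split-unique (dependentPairs-unique (λ μ → ssyt μ n) (interlacing-unique κ) (λ μ → ssyt-unique μ n)) split⊆ ⊆split ⟩
    ∑ g (dependentPairs (interlacing κ) (λ μ → ssyt μ n))
      ≈⟨ ∑-concatMap g (λ μ → map (μ ,_) (ssyt μ n)) (interlacing κ) ⟩
    ∑ (λ μ → ∑ g (map (μ ,_) (ssyt μ n))) (interlacing κ)
      ≈⟨ ∑-cong (interlacing κ) (λ {μ} _ → fibre μ) ⟩
    ∑ (λ μ → pow R q (suc n * (sum κ ∸ sum μ)) · schur R μ (powers n)) (interlacing κ) ∎
    where
    open Branching n
    open Splitting dec len
    g : List ℕ × List (List ℕ) → Carrier
    g (μ , T) = pow R q (sum (entries T) + suc n * (sum κ ∸ sum μ))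
    fibre : ∀ μ → ∑ g (map (μ ,_) (ssyt μ n)) ≈ pow R q (suc n * (sum κ ∸ sum μ)) · schur R μ (powers n)
    fibre μ = begin
      ∑ g (map (μ ,_) (ssyt μ n))
        ≈⟨ ∑-map g (μ ,_) (ssyt μ n) ⟩
      ∑ (λ T → pow R q (sum (entries T) + K)) (ssyt μ n)
        ≈⟨ ∑-cong (ssyt μ n) (λ {T} _ → ≈-trans (pow-+ q (sum (entries T)) K) (*-comm _ _)) ⟩
      ∑ (λ T → pow R q K · tableauWeight T) (ssyt μ n)
        ≈⟨ *-distribˡ-∑ (pow R q K) tableauWeight (ssyt μ n) ⟨
      pow R q K · ∑ tableauWeight (ssyt μ n)
        ≈⟨ *-congˡ (schur-powers μ n) ⟨
      pow R q K · schur R μ (powers n) ∎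
      where
      K = suc n * (sum κ ∸ sum μ)

-- Exponent bookkeeping

tilts+verticals : ∀ k r → rightTilts r + leftTilts r + length (verticals k r) ≡ length r
tilts+verticals k [] = refl
tilts+verticals k (rightTilt ∷ r) = cong suc (tilts+verticals (suc k) r)
tilts+verticals k (leftTilt ∷ r) = trans (cong (_+ length (verticals (suc k) r)) (ℕ.+-suc (rightTilts r) (leftTilts r))) (cong suc (tilts+verticals (suc k) r))
tilts+verticals k (vertical ∷ r) = trans (ℕ.+-suc _ (length (verticals (suc k) r))) (cong suc (tilts+verticals (suc k) r))

tiltPositions+verticals : ∀ k r → tiltPositions k r + sum (verticals k r) + choose2 k ≡ choose2 (k + length r)
tiltPositions+verticals k [] = cong choose2 (sym (ℕ.+-identityʳ k))
tiltPositions+verticals k (d ∷ r) = trans (step d) (trans (tiltPositions+verticals (suc k) r) (cong choose2 (sym (ℕ.+-suc k (length r)))))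
  where
  t = tiltPositions (suc k) r
  v = sum (verticals (suc k) r)
  tilted : ∀ k t v c → k + t + v + c ≡ t + v + (k + c)
  tilted = solve-∀
  upright : ∀ k t v c → t + (k + v) + c ≡ t + v + (k + c)
  upright = solve-∀
  step : ∀ d → tiltPositions k (d ∷ r) + sum (verticals k (d ∷ r)) + choose2 k ≡ t + v + choose2 (suc k)
  step rightTilt = tilted k t v (choose2 k)
  step leftTilt = tilted k t v (choose2 k)
  step vertical = upright k t v (choose2 k)

choose2-+ : ∀ a b → choose2 (suc (a + b)) ≡ choose2 (suc a) + choose2 (suc b) + a * b
choose2-+ zero b = sym (ℕ.+-identityʳ _)
choose2-+ (suc a) b = trans (cong (suc (a + b) +_) (choose2-+ a b)) (rearrange a b (choose2 (suc a)) (choose2 (suc b)))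
  where
  rearrange : ∀ a b A B → suc (a + b) + (A + B + a * b) ≡ suc (a + A) + B + suc a * b
  rearrange = solve-∀

filterᵇ-ascending : ∀ (p : ℕ → Bool) {k xs} → Ascending k xs → Ascending k (filterᵇ p xs)
filterᵇ-ascending p [] = []
filterᵇ-ascending p {xs = x ∷ xs} (k≤x ∷ xs↑) with p x
... | true = k≤x ∷ filterᵇ-ascending p xs↑
... | false = ascending-weaken (ℕ.m≤n⇒m≤1+n k≤x) (filterᵇ-ascending p xs↑)

map-suc-ascending : ∀ {k xs} → Ascending k xs → Ascending (suc k) (map suc xs)
map-suc-ascending [] = []
map-suc-ascending (k≤x ∷ xs↑) = s≤s k≤x ∷ map-suc-ascending xs↑

range1-ascending : ∀ n → Ascending 1 (range1 n)
range1-ascending zero = []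
range1-ascending (suc n) = subst (Ascending 1) (sym (range1-suc n)) (ℕ.≤-refl ∷ map-suc-ascending (range1-ascending n))

filterᵇ-partition : ∀ (p : ℕ → Bool) xs → filterᵇ p xs ++ filterᵇ (not ∘ p) xs ↭ xs
filterᵇ-partition p [] = ↭-refl
filterᵇ-partition p (x ∷ xs) with p x
... | true = ↭-prep x (filterᵇ-partition p xs)
... | false = ↭-trans (↭-shift x (filterᵇ p xs) (filterᵇ (not ∘ p) xs)) (↭-prep x (filterᵇ-partition p xs))

dents↭ : ∀ {N S} → Ascending 1 S → All (_≤ N) S → filterᵇ (λ k → elemℕ k S) (range1 N) ↭ S
dents↭ {N} {S} S↑ S≤N = sameMembers⇒↭ (filterᵇ-unique _ (range1-unique N)) (ascending-unique S↑)
  (λ k∈ → elemℕ⇒∈ _ S (proj₂ (∈-filterᵇ⁻ (λ k → elemℕ k S) {xs = range1 N} k∈)))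
  (λ k∈ → ∈-filterᵇ⁺ (λ k → elemℕ k S) (∈-range1⁺ (All.lookup (ascending-lowerBound S↑) k∈) (All.lookup S≤N k∈)) (∈⇒elemℕ _ S k∈))

sum-lambdaOf+choose2 : ∀ {S} → Ascending 1 S → sum (lambdaOf S) + choose2 (suc (length S)) ≡ sum S
sum-lambdaOf+choose2 {S} S↑ = trans (cong (_+ choose2 (suc (length S))) (sum-lambdaOf S)) (trans (sum-offsets S S↑) (ℕ.+-identityʳ (sum S)))

sumRminusI+sum-lambdaOf : ∀ a b {S} → Ascending 1 S → All (_≤ a + b) S → length S ≡ a → sumRminusI a b S + sum (lambdaOf S) ≡ a * b
sumRminusI+sum-lambdaOf a b {S} S↑ S≤ lenS = ℕ.+-cancelʳ-≡ (choose2 (suc a) + choose2 (suc b)) _ _ (begin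
  sumRminusI a b S + sum (lambdaOf S) + (choose2 (suc a) + choose2 (suc b))
    ≡⟨ regroup (sumRminusI a b S) (sum (lambdaOf S)) (choose2 (suc a)) (choose2 (suc b)) ⟩
  sumRminusI a b S + (sum (lambdaOf S) + choose2 (suc a) + choose2 (suc b))
    ≡⟨ cong₂ (λ u v → u + (v + choose2 (suc b))) (sumRminusI≡sum-offsets a b S) (trans (cong (λ n → sum (lambdaOf S) + choose2 (suc n)) (sym lenS)) (sum-lambdaOf+choose2 S↑)) ⟩
  sum (offsets 1 R) + (sum S + choose2 (suc b))
    ≡⟨ swap (sum (offsets 1 R)) (sum S) (choose2 (suc b)) ⟩
  sum (offsets 1 R) + choose2 (suc b) + sum S
    ≡⟨ cong₂ _+_ (trans (cong (λ n → sum (offsets 1 R) + choose2 (suc n)) (sym lenR)) (trans (sum-offsets R R↑) (ℕ.+-identityʳ (sum R)))) (sym (sum-↭ (dents↭ S↑ S≤))) ⟩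
  sum R + sum D
    ≡⟨ ℕ.+-comm (sum R) (sum D) ⟩
  sum D + sum R
    ≡⟨ sum-++ D R ⟨
  sum (D ++ R)
    ≡⟨ sum-↭ (filterᵇ-partition _ (range1 (a + b))) ⟩
  sum (range1 (a + b))
    ≡⟨ trans (sum-range1 (a + b)) (choose2-+ a b) ⟩
  choose2 (suc a) + choose2 (suc b) + a * b
    ≡⟨ ℕ.+-comm _ (a * b) ⟩
  a * b + (choose2 (suc a) + choose2 (suc b))
    ∎)
  where
  open ≡-Reasoning
  D = filterᵇ (λ k → elemℕ k S) (range1 (a + b))
  R = complementList a b S
  R↑ : Ascending 1 R
  R↑ = filterᵇ-ascending _ (range1-ascending (a + b))
  lenR : length R ≡ b
  lenR = ℕ.+-cancelˡ-≡ a _ _ (begin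
    a + length R              ≡⟨ cong (_+ length R) (trans (sym lenS) (sym (↭-length (dents↭ S↑ S≤)))) ⟩
    length D + length R       ≡⟨ length-++ D ⟨
    length (D ++ R)           ≡⟨ ↭-length (filterᵇ-partition _ (range1 (a + b))) ⟩
    length (range1 (a + b))   ≡⟨ length-range1 (a + b) ⟩
    a + b                     ∎)
  swap : ∀ r s c → r + (s + c) ≡ r + c + s
  swap = solve-∀
  regroup : ∀ y l A B → y + l + (A + B) ≡ y + (l + A + B)
  regroup = solve-∀

interlaced-below : ∀ {N c S E} → Interlaced c S E → All (_≤ N) S → All (_< N) E
interlaced-below [] _ = []
interlaced-below (vertical-first e<s il) S≤N@(s≤N ∷ _) = ℕ.<-≤-trans e<s s≤N ∷ interlaced-below il S≤N
interlaced-below (dent-first _ il) (_ ∷ S≤N) = interlaced-below il S≤N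

length≡0 : ∀ (xs : List A) → length xs ≡ 0 → xs ≡ []
length≡0 [] _ = refl

allDirs-unique : Unique allDirs
allDirs-unique = ((λ ()) ∷ (λ ()) ∷ []) ∷ ((λ ()) ∷ []) ∷ [] ∷ []

∈-allDirs : ∀ d → d ∈ allDirs
∈-allDirs rightTilt = here refl
∈-allDirs leftTilt = there (here refl)
∈-allDirs vertical = there (there (here refl))

-- r ↦ λ(verticals r) is a bijection from the valid bottom rows of SH_{a+1,b}(S) onto the partitions interlacing λ(S).
module BottomRows (a b : ℕ) {S : List ℕ} (S↑ : Ascending 1 S) (S≤ : All (_≤ suc a + b) S) (lenS : length S ≡ suc a) where
  N = a + b + 1
  open RowsOfWidth N

  S≤N : All (_≤ N) S
  S≤N = All.map (λ {s} s≤ → subst (s ≤_) (ℕ.+-comm 1 (a + b)) s≤) S≤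

  rows : List (List Dir)
  rows = filter (validBottomRow? a S) (listsOf allDirs (a + b))

  partitionOf : List Dir → List ℕ
  partitionOf r = lambdaOf (verticals 1 r)

  record Row (r : List Dir) : Set where
    field
      row-length : length r ≡ a + b
      accepts : Accepts (λ k → elemℕ k S) false 1 r
      shape : RowShape false 1 r S
    E = verticals 1 r
    E↑ : Ascending 1 E
    E↑ = verticals-ascending 1 r
    E≤ : All (_≤ a + b) E
    E≤ = All.map (λ {e} e< → ℕ.≤-pred (subst (e <_) (cong suc row-length) e<)) (verticals-bounded 1 r)
    lenE : length E ≡ a
    lenE = ℕ.suc-injective (trans (ℕ.+-comm 1 (length E)) (trans (RowShape.verticals-length shape) lenS))

  row : ∀ {r} → r ∈ rows → Row r
  row {r} r∈ = record { row-length = len ; accepts = acc ; shape = accepts⇒shape r S↑ S≤N (trans (cong suc len) (ℕ.+-comm 1 (a + b))) acc }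
    where
    r∈′ : r ∈ listsOf allDirs (a + b) × ValidBottomRow a S r
    r∈′ = ∈-filter⁻ (validBottomRow? a S) {xs = listsOf allDirs (a + b)} r∈
    len : length r ≡ a + b
    len = proj₁ (∈-listsOf⁻ allDirs (a + b) (proj₁ r∈′))
    acc : Accepts (λ k → elemℕ k S) false 1 r
    acc = proj₁ (proj₂ r∈′)

  partitionOf-unique : Unique (map partitionOf rows)
  partitionOf-unique = map-unique-injectiveOn partitionOf (Unique.filter⁺ (validBottomRow? a S) (listsOf-unique (a + b) allDirs-unique))
    λ {r₁} {r₂} r₁∈ r₂∈ eq → let open Row in
      accepts-injective (accepts (row r₁∈)) (accepts (row r₂∈)) (trans (row-length (row r₁∈)) (sym (row-length (row r₂∈))))
        (offsets-injective (E↑ (row r₁∈)) (E↑ (row r₂∈))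
          (reverse-injective (trans (sym (lambdaOf≡reverse-offsets (verticals 1 r₁))) (trans eq (lambdaOf≡reverse-offsets (verticals 1 r₂))))))

  partitionOf⊆ : ∀ {μ} → μ ∈ map partitionOf rows → μ ∈ interlacing (lambdaOf S)
  partitionOf⊆ μ∈ with r , r∈ , refl ← ∈-map⁻ partitionOf μ∈ =
    let open Row (row r∈) in
    ∈-interlacing⁺ (subst₂ _≺_ (sym (lambdaOf≡reverse-offsets E)) (sym (lambdaOf≡reverse-offsets S))
      (interlaced⇒≺ S↑ E↑ (RowShape.interlaced shape)))

  ⊆partitionOf : ∀ {μ} → μ ∈ interlacing (lambdaOf S) → μ ∈ map partitionOf rows
  ⊆partitionOf {μ} μ∈ =
    let (E , E↑ , il , E↦μ) = ≺⇒interlaced S S↑ (subst (μ ≺_) (lambdaOf≡reverse-offsets S) (∈-interlacing⁻ (lambdaOf S) μ∈))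
        (r , len , acc , vs) = interlaced⇒row (a + b) refl S↑ S≤N E↑ (interlaced-below il S≤N) il
        lenE : length (verticals 1 r) ≡ a
        lenE = ℕ.suc-injective (trans (ℕ.+-comm 1 _) (trans (RowShape.verticals-length (accepts⇒shape r S↑ S≤N (trans (cong suc len) (ℕ.+-comm 1 (a + b))) acc)) lenS))
        flat : a ≡ 0 → verticals 1 r ≡ []
        flat a≡0 = length≡0 (verticals 1 r) (trans lenE a≡0)
        r∈ = ∈-filter⁺ (validBottomRow? a S) (∈-listsOf⁺ allDirs (a + b) (len , All.tabulate (λ {d} _ → ∈-allDirs d))) (acc , flat)
    in subst (_∈ map partitionOf rows) (trans (lambdaOf≡reverse-offsets (verticals 1 r)) (trans (cong (reverse ∘ offsets 1) vs) E↦μ)) (∈-map⁺ partitionOf r∈)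

  module Exponents {r} (valid : Row r) where
    open Row valid
    L = sum (lambdaOf S)
    M = sum (lambdaOf E)
    Y = sumRminusI (suc a) b S
    YE = sumRminusI a b E
    open ≡-Reasoning

    tilts : rightTilts r + leftTilts r ≡ b
    tilts = ℕ.+-cancelʳ-≡ a _ _ (begin
      rightTilts r + leftTilts r + a              ≡⟨ cong (rightTilts r + leftTilts r +_) lenE ⟨
      rightTilts r + leftTilts r + length E       ≡⟨ tilts+verticals 1 r ⟩
      length r                                    ≡⟨ row-length ⟩
      a + b                                       ≡⟨ ℕ.+-comm a b ⟩
      b + a                                       ∎)

    leftTilts+L : leftTilts r + L ≡ b + M
    leftTilts+L = ℕ.+-cancelʳ-≡ (suc a + choose2 (suc a)) _ _ (begin
      leftTilts r + L + (suc a + choose2 (suc a))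
        ≡⟨ regroup (leftTilts r) L (suc a + choose2 (suc a)) ⟩
      leftTilts r + (L + choose2 (suc (suc a))) + 0
        ≡⟨ cong (λ s → leftTilts r + s + 0) (trans (cong (λ n → L + choose2 (suc n)) (sym lenS)) (sum-lambdaOf+choose2 S↑)) ⟩
      leftTilts r + sum S + 0
        ≡⟨ RowShape.leftTilts-sum shape ⟩
      a + b + 1 + sum E
        ≡⟨ cong (a + b + 1 +_) (trans (cong (λ n → M + choose2 (suc n)) (sym lenE)) (sum-lambdaOf+choose2 E↑)) ⟨
      a + b + 1 + (M + choose2 (suc a))
        ≡⟨ shuffle a b M (choose2 (suc a)) ⟩
      b + M + (suc a + choose2 (suc a)) ∎)
      where
      regroup : ∀ n l k → n + l + k ≡ n + (l + k) + 0
      regroup = solve-∀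
      shuffle : ∀ a b m c → a + b + 1 + (m + c) ≡ b + m + (suc a + c)
      shuffle = solve-∀

    rightTilts+M : rightTilts r + M ≡ L
    rightTilts+M = ℕ.+-cancelʳ-≡ (leftTilts r + L) _ _ (begin
      rightTilts r + M + (leftTilts r + L)        ≡⟨ regroup (rightTilts r) M (leftTilts r) L ⟩
      rightTilts r + leftTilts r + L + M          ≡⟨ cong (λ t → t + L + M) tilts ⟩
      b + L + M                                   ≡⟨ shuffle b L M ⟩
      L + (b + M)                                 ≡⟨ cong (L +_) leftTilts+L ⟨
      L + (leftTilts r + L)                       ∎)
      where
      regroup : ∀ p m n l → p + m + (n + l) ≡ p + n + l + m
      regroup = solve-∀
      shuffle : ∀ b l m → b + l + m ≡ l + (b + m)
      shuffle = solve-∀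

    leftTilts+YE : leftTilts r + YE ≡ Y
    leftTilts+YE = ℕ.+-cancelʳ-≡ (L + M) _ _ (begin
      leftTilts r + YE + (L + M)         ≡⟨ regroup (leftTilts r) YE L M ⟩
      (leftTilts r + L) + (YE + M)       ≡⟨ cong₂ _+_ leftTilts+L (sumRminusI+sum-lambdaOf a b E↑ E≤ lenE) ⟩
      b + M + a * b                      ≡⟨ shuffle b M a ⟩
      suc a * b + M                      ≡⟨ cong (_+ M) (sumRminusI+sum-lambdaOf (suc a) b S↑ S≤ lenS) ⟨
      Y + L + M                          ≡⟨ ℕ.+-assoc Y L M ⟩
      Y + (L + M)                        ∎)
      where
      regroup : ∀ n y l m → n + y + (l + m) ≡ (n + l) + (y + m)
      regroup = solve-∀
      shuffle : ∀ b m a → b + m + a * b ≡ suc a * b + m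
      shuffle = solve-∀

    tiltPositions≡ : tiltPositions 1 r ≡ choose2 (suc b) + YE
    tiltPositions≡ = ℕ.+-cancelʳ-≡ (M + choose2 (suc a)) _ _ (begin
      tiltPositions 1 r + (M + choose2 (suc a))
        ≡⟨ cong (tiltPositions 1 r +_) (trans (cong (λ n → M + choose2 (suc n)) (sym lenE)) (sum-lambdaOf+choose2 E↑)) ⟩
      tiltPositions 1 r + sum E
        ≡⟨ ℕ.+-identityʳ _ ⟨
      tiltPositions 1 r + sum E + 0
        ≡⟨ tiltPositions+verticals 1 r ⟩
      choose2 (suc (length r))
        ≡⟨ cong (λ n → choose2 (suc n)) row-length ⟩
      choose2 (suc (a + b))
        ≡⟨ choose2-+ a b ⟩
      choose2 (suc a) + choose2 (suc b) + a * b
        ≡⟨ cong (choose2 (suc a) + choose2 (suc b) +_) (sumRminusI+sum-lambdaOf a b E↑ E≤ lenE) ⟨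
      choose2 (suc a) + choose2 (suc b) + (YE + M)
        ≡⟨ shuffle (choose2 (suc a)) (choose2 (suc b)) YE M ⟩
      choose2 (suc b) + YE + (M + choose2 (suc a)) ∎)
      where
      shuffle : ∀ c d y m → c + d + (y + m) ≡ d + y + (m + c)
      shuffle = solve-∀

    L∸M : L ∸ M ≡ rightTilts r
    L∸M = trans (cong (_∸ M) (sym rightTilts+M)) (ℕ.m+n∸n≡m (rightTilts r) M)

    q-exponent : tiltPositions 1 r + b * a + (a * choose2 b + a * YE) ≡ suc a * choose2 b + suc a * Y + suc a * (L ∸ M)
    q-exponent = begin
      tiltPositions 1 r + b * a + (a * choose2 b + a * YE)
        ≡⟨ cong (λ t → t + b * a + (a * choose2 b + a * YE)) tiltPositions≡ ⟩
      b + choose2 b + YE + b * a + (a * choose2 b + a * YE)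
        ≡⟨ cong (λ t → t + choose2 b + YE + t * a + (a * choose2 b + a * YE)) tilts ⟨
      (rightTilts r + leftTilts r) + choose2 b + YE + (rightTilts r + leftTilts r) * a + (a * choose2 b + a * YE)
        ≡⟨ collect (rightTilts r) (leftTilts r) (choose2 b) YE a ⟩
      suc a * choose2 b + suc a * (leftTilts r + YE) + suc a * rightTilts r
        ≡⟨ cong₂ (λ u v → suc a * choose2 b + suc a * u + suc a * v) leftTilts+YE (sym L∸M) ⟩
      suc a * choose2 b + suc a * Y + suc a * (L ∸ M)
        ∎
      where
      collect : ∀ p n c y a → p + n + c + y + (p + n) * a + (a * c + a * y) ≡ suc a * c + suc a * (n + y) + suc a * p
      collect = solve-∀

-- The induction on the number of rows

module Main {c ℓ : Level} (R : CommutativeRing c ℓ) (x y q : CommutativeRing.Carrier R) where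
  open CommutativeRing R renaming (_+_ to _+ᴿ_; _*_ to _·_; refl to ≈-refl; sym to ≈-sym; trans to ≈-trans)
  open RingSums R
  open TilingSum R x y q
  open Schur R q
  open import Relation.Binary.Reasoning.Setoid setoid
  open import Algebra.Solver.CommutativeMonoid *-commutativeMonoid using (solve; _⊜_; _⊕_)

  rowLozenges-weight : ∀ k r → prodR R (map (lozengeWeight R x y q) (rowLozenges 1 k r))
    ≈ (pow R x (rightTilts r) · pow R y (leftTilts r)) · pow R q (tiltPositions k r)
  rowLozenges-weight k [] = ≈-sym (≈-trans (*-identityʳ _) (*-identityʳ _))
  rowLozenges-weight k (rightTilt ∷ r) = begin
    (x · pow R q k) · prodR R (map (lozengeWeight R x y q) (rowLozenges 1 (suc k) r))
      ≈⟨ *-congˡ (rowLozenges-weight (suc k) r) ⟩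
    (x · pow R q k) · ((pow R x (rightTilts r) · pow R y (leftTilts r)) · pow R q (tiltPositions (suc k) r))
      ≈⟨ solve 5 (λ a b c d e → (a ⊕ b) ⊕ ((c ⊕ d) ⊕ e) ⊜ ((a ⊕ c) ⊕ d) ⊕ (b ⊕ e)) ≈-refl x (pow R q k) (pow R x (rightTilts r)) (pow R y (leftTilts r)) (pow R q (tiltPositions (suc k) r)) ⟩
    ((x · pow R x (rightTilts r)) · pow R y (leftTilts r)) · (pow R q k · pow R q (tiltPositions (suc k) r))
      ≈⟨ *-congˡ (pow-+ q k (tiltPositions (suc k) r)) ⟨
    (pow R x (rightTilts (rightTilt ∷ r)) · pow R y (leftTilts r)) · pow R q (tiltPositions k (rightTilt ∷ r))
      ∎
  rowLozenges-weight k (leftTilt ∷ r) = begin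
    (y · pow R q k) · prodR R (map (lozengeWeight R x y q) (rowLozenges 1 (suc k) r))
      ≈⟨ *-congˡ (rowLozenges-weight (suc k) r) ⟩
    (y · pow R q k) · ((pow R x (rightTilts r) · pow R y (leftTilts r)) · pow R q (tiltPositions (suc k) r))
      ≈⟨ solve 5 (λ a b c d e → (a ⊕ b) ⊕ ((c ⊕ d) ⊕ e) ⊜ (c ⊕ (a ⊕ d)) ⊕ (b ⊕ e)) ≈-refl y (pow R q k) (pow R x (rightTilts r)) (pow R y (leftTilts r)) (pow R q (tiltPositions (suc k) r)) ⟩
    (pow R x (rightTilts r) · (y · pow R y (leftTilts r))) · (pow R q k · pow R q (tiltPositions (suc k) r))
      ≈⟨ *-congˡ (pow-+ q k (tiltPositions (suc k) r)) ⟨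
    (pow R x (rightTilts r) · pow R y (leftTilts (leftTilt ∷ r))) · pow R q (tiltPositions k (leftTilt ∷ r))
      ∎
  rowLozenges-weight k (vertical ∷ r) = ≈-trans (*-identityˡ _) (rowLozenges-weight (suc k) r)

  Formula : ℕ → ℕ → List ℕ → Set ℓ
  Formula a b S = weightedTilings R a b S x y q · pow R q (b * choose2 a)
    ≈ ((pow R x (sum (lambdaOf S)) · pow R y (sumRminusI a b S)) · pow R q (a * choose2 b + a * sumRminusI a b S)) · schur R (lambdaOf S) (powers a)

  formula-zero : ∀ b → Formula 0 b []
  formula-zero b = begin
    (1# +ᴿ 0#) · pow R q (b * 0)
      ≈⟨ *-cong (+-identityʳ 1#) (pow-cong q (ℕ.*-zeroʳ b)) ⟩
    1# · 1#
      ≈⟨ *-congʳ (≈-sym (≈-trans (*-congʳ (*-congˡ (pow-cong y no-complement-offsets))) (≈-trans (*-identityʳ _) (*-identityʳ _)))) ⟩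
    ((1# · pow R y (sumRminusI 0 b [])) · 1#) · 1#
      ≈⟨ *-congˡ (+-identityʳ 1#) ⟨
    ((1# · pow R y (sumRminusI 0 b [])) · 1#) · (1# +ᴿ 0#) ∎
    where
    no-complement-offsets : sumRminusI 0 b [] ≡ 0
    no-complement-offsets = trans (sym (ℕ.+-identityʳ _)) (sumRminusI+sum-lambdaOf 0 b [] [] refl)

  -- Peeling the bottom row multiplies the induction hypothesis for the dents E by the row weight.
  row-term : ∀ a b {S} (S↑ : Ascending 1 S) (S≤ : All (_≤ suc a + b) S) (lenS : length S ≡ suc a) →
    let open BottomRows a b S↑ S≤ lenS in ∀ {r} (valid : Row r) → Formula a b (Row.E valid) →
    (rowWeight r · weightedTilings R a b (verticals 1 r) x y q) · pow R q (b * choose2 (suc a))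
      ≈ ((pow R x (sum (lambdaOf S)) · pow R y (sumRminusI (suc a) b S)) · pow R q (suc a * choose2 b + suc a * sumRminusI (suc a) b S))
        · (pow R q (suc a * (sum (lambdaOf S) ∸ sum (lambdaOf (verticals 1 r)))) · schur R (lambdaOf (verticals 1 r)) (powers a))
  row-term a b {S} S↑ S≤ lenS {r} valid ih = begin
    (rowWeight r · W) · pow R q (b * choose2 (suc a))
      ≈⟨ *-cong (*-congʳ (rowLozenges-weight 1 r)) (≈-trans (pow-cong q (ℕ.*-distribˡ-+ b a (choose2 a))) (pow-+ q (b * a) (b * choose2 a))) ⟩
    (((X₁ · Y₁) · Q₁) · W) · (Qa · Qb)
      ≈⟨ solve 6 (λ a b c d e f → (((a ⊕ b) ⊕ c) ⊕ d) ⊕ (e ⊕ f) ⊜ ((a ⊕ b) ⊕ (c ⊕ e)) ⊕ (d ⊕ f)) ≈-refl X₁ Y₁ Q₁ W Qa Qb ⟩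
    ((X₁ · Y₁) · (Q₁ · Qa)) · (W · Qb)
      ≈⟨ *-congˡ ih ⟩
    ((X₁ · Y₁) · (Q₁ · Qa)) · (((pow R x M · pow R y YE) · QE) · Sch)
      ≈⟨ solve 8 (λ a b c d e f g i → ((a ⊕ b) ⊕ (c ⊕ d)) ⊕ (((e ⊕ f) ⊕ g) ⊕ i) ⊜ (((a ⊕ e) ⊕ (b ⊕ f)) ⊕ ((c ⊕ d) ⊕ g)) ⊕ i)
           ≈-refl X₁ Y₁ Q₁ Qa (pow R x M) (pow R y YE) QE Sch ⟩
    (((X₁ · pow R x M) · (Y₁ · pow R y YE)) · ((Q₁ · Qa) · QE)) · Sch
      ≈⟨ *-congʳ (*-cong (*-cong (≈-sym (pow-+ x (rightTilts r) M)) (≈-sym (pow-+ y (leftTilts r) YE)))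
           (≈-trans (*-congʳ (≈-sym (pow-+ q (tiltPositions 1 r) (b * a)))) (≈-sym (pow-+ q (tiltPositions 1 r + b * a) _)))) ⟩
    ((pow R x (rightTilts r + M) · pow R y (leftTilts r + YE)) · pow R q (tiltPositions 1 r + b * a + (a * choose2 b + a * YE))) · Sch
      ≈⟨ *-congʳ (*-cong (*-cong (pow-cong x rightTilts+M) (pow-cong y leftTilts+YE))
           (≈-trans (pow-cong q q-exponent) (pow-+ q (suc a * choose2 b + suc a * Y) (suc a * (L ∸ M))))) ⟩
    ((pow R x L · pow R y Y) · (pow R q (suc a * choose2 b + suc a * Y) · pow R q (suc a * (L ∸ M)))) · Sch
      ≈⟨ solve 5 (λ a b c d e → ((a ⊕ b) ⊕ (c ⊕ d)) ⊕ e ⊜ ((a ⊕ b) ⊕ c) ⊕ (d ⊕ e)) ≈-refl (pow R x L) (pow R y Y) (pow R q (suc a * choose2 b + suc a * Y)) (pow R q (suc a * (L ∸ M))) Sch ⟩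
    ((pow R x L · pow R y Y) · pow R q (suc a * choose2 b + suc a * Y)) · (pow R q (suc a * (L ∸ M)) · Sch)
      ∎
    where
    open BottomRows a b S↑ S≤ lenS
    open Exponents valid
    W = weightedTilings R a b (verticals 1 r) x y q
    X₁ = pow R x (rightTilts r)
    Y₁ = pow R y (leftTilts r)
    Q₁ = pow R q (tiltPositions 1 r)
    Qa = pow R q (b * a)
    Qb = pow R q (b * choose2 a)
    QE = pow R q (a * choose2 b + a * YE)
    Sch = schur R (lambdaOf (verticals 1 r)) (powers a)

  formula : ∀ a b {S} → Ascending 1 S → All (_≤ a + b) S → length S ≡ a → Formula a b S
  formula zero b {[]} _ _ _ = formula-zero b
  formula (suc a) b {S} S↑ S≤ lenS = begin
    weightedTilings R (suc a) b S x y q · Q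
      ≈⟨ *-congʳ (weightedTilings-suc a b S (validBottomRow? a S) (bottomRow⇔valid a b S)) ⟩
    ∑ G rows · Q
      ≈⟨ *-distribʳ-∑ Q G rows ⟩
    ∑ (λ r → G r · Q) rows
      ≈⟨ ∑-cong rows (λ r∈ → let valid = row r∈ in row-term a b S↑ S≤ lenS valid (formula a b (Row.E↑ valid) (Row.E≤ valid) (Row.lenE valid))) ⟩
    ∑ (λ r → K · h (partitionOf r)) rows
      ≈⟨ *-distribˡ-∑ K (h ∘ partitionOf) rows ⟨
    K · ∑ (h ∘ partitionOf) rows
      ≈⟨ *-congˡ (∑-map h partitionOf rows) ⟨
    K · ∑ h (map partitionOf rows)
      ≈⟨ *-congˡ (∑-sameMembers h partitionOf-unique (interlacing-unique (lambdaOf S)) partitionOf⊆ ⊆partitionOf) ⟩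
    K · ∑ h (interlacing (lambdaOf S))
      ≈⟨ *-congˡ (schur-branching a (lambdaOf S) (subst Decreasing (sym (lambdaOf≡reverse-offsets S)) (reverse-offsets-decreasing S S↑)) (trans (length-lambdaOf S) lenS)) ⟨
    K · schur R (lambdaOf S) (powers (suc a)) ∎
    where
    open BottomRows a b S↑ S≤ lenS
    Q = pow R q (b * choose2 (suc a))
    G : List Dir → Carrier
    G r = rowWeight r · weightedTilings R a b (verticals 1 r) x y q
    L = sum (lambdaOf S)
    K = (pow R x L · pow R y (sumRminusI (suc a) b S)) · pow R q (suc a * choose2 b + suc a * sumRminusI (suc a) b S)
    h : List ℕ → Carrier
    h μ = pow R q (suc a * (L ∸ sum μ)) · schur R μ (powers a)

ascending-toList : ∀ {n} (v : Vec ℕ n) {k} → (∀ i → k ≤ lookup v i) → (∀ (i j : Fin n) → i Fin.< j → lookup v i < lookup v j) →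
  Ascending k (toList v)
ascending-toList Vec.[] _ _ = []
ascending-toList (x Vec.∷ xs) lower mono =
  lower Fin.zero ∷ ascending-toList xs (λ i → mono Fin.zero (Fin.suc i) (s≤s z≤n)) (λ i j i<j → mono (Fin.suc i) (Fin.suc j) (s≤s i<j))

bounded-toList : ∀ {n} (v : Vec ℕ n) {m} → (∀ i → lookup v i ≤ m) → All (_≤ m) (toList v)
bounded-toList Vec.[] _ = []
bounded-toList (x Vec.∷ xs) upper = upper Fin.zero ∷ bounded-toList xs (upper ∘ Fin.suc)

lemma2p9 : ∀ {c ℓ : Level} (R : CommutativeRing c ℓ) (a b : ℕ) (s : Vec ℕ a)
    → (∀ i → 1 ≤ lookup s i)
    → (∀ i → lookup s i ≤ a + b)
    → (∀ (i j : Fin a) → i Fin.< j → lookup s i < lookup s j)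
    → (x y q : CommutativeRing.Carrier R)
    → let open CommutativeRing R using (_≈_) renaming (_*_ to _·_)
          S  = toList s
          Σr = sumRminusI a b S
      in weightedTilings R a b S x y q · pow R q (b * choose2 a)
         ≈ pow R x (a * b ∸ Σr) · pow R y Σr
           · pow R q (a * choose2 b + a * Σr)
           · schur R (lambdaOf S) (map (pow R q) (range1 a))
lemma2p9 R a b s lower upper mono x y q =
  ≈-trans (Main.formula R x y q a b S↑ S≤ (length-toList s)) (*-congʳ (*-congʳ (*-congʳ (RingSums.pow-cong R x x-exponent))))
  where
  open CommutativeRing R using (*-congʳ) renaming (trans to ≈-trans)
  S↑ : Ascending 1 (toList s)
  S↑ = ascending-toList s lower mono
  S≤ : All (_≤ a + b) (toList s)
  S≤ = bounded-toList s upper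
  x-exponent : sum (lambdaOf (toList s)) ≡ a * b ∸ sumRminusI a b (toList s)
  x-exponent = sym (trans (cong (_∸ sumRminusI a b (toList s)) (sym (sumRminusI+sum-lambdaOf a b S↑ S≤ (length-toList s))))
                          (ℕ.m+n∸m≡n (sumRminusI a b (toList s)) _))
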